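{- Let $G$ be a weighted graph. (a) If $a$ is a looped vertex of $G$ then $q(G)=\beta(a)\,q(G-a)+\alpha(a)(x-1)\,q(G^{a}-a)$. (b) If $a$ and $b$ are distinct adjacent unlooped vertices of $G$ then \[ q(G)=\beta(a)q(G-a)+\beta(b)q(G^{ab}-b)+\big(\alpha(a)\alpha(b)(x-1)^{2}-\beta(a)\beta(b)\big)q(G^{ab}-a-b). \] (c) If $G$ has no non-loop edges then \[ q(G)=\Big(\prod_{v\ \mathrm{unlooped}}\big(\alpha(v)(y-1)+\beta(v)\big)\Big)\cdot\Big(\prod_{v\ \mathrm{looped}}\big(\alpha(v)(x-1)+\beta(v)\big)\Big). \]
   Context: All graphs are finite and may have loops (at most one per vertex) but no multiple edges. The adjacency matrix of a graph is the symmetric $0/1$ matrix over $GF(2)$ whose diagonal entry at $v$ is $1$ iff $v$ is looped; $r(G)$, $n(G)$ are its rank and nullity over $GF(2)$ (empty graph: $r=n=0$). For $S\subseteq V(G)$, $G[S]$ is the induced subgraph. Let $A$ be a commutative ring with unity containing elements $x,y$. A weighted graph is a graph $G$ with functions $\alpha,\beta:V(G)\to A$, and \[ q(G)=\sum_{S\subseteq V(G)}\Big(\prod_{s\in S}\alpha(s)\Big)\Big(\prod_{v\notin S}\beta(v)\Big)(x-1)^{r(G[S])}(y-1)^{n(G[S])}. \] Graph operations keep vertex weights. Local complement $G^a$: toggle the adjacency $\{u,w\}$ for all neighbors $u,w$ of $a$ distinct from $a$, including $u=w$ (so loops at neighbors of $a$ are toggled). Pivot $G^{ab}$ ($a\ne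 b$): toggle $\{u,w\}$ for all $u,w\notin\{a,b\}$ with $u$ adjacent to $a$, $w$ adjacent to $b$, and either $u$ not adjacent to $b$ or $w$ not adjacent to $a$ (no loops toggled). -}

module Defs where

open import Data.Nat using (ℕ; zero; suc; _∸_; _⊔_)
open import Data.Bool using (Bool; true; false; _∧_; _∨_; not; _xor_; if_then_else_)
open import Data.Fin using (Fin; zero; suc; punchIn; _≟_)
open import Data.List using (List; []; _∷_; concatMap; foldr)
open import Relation.Nullary using (does)
open import Relation.Binary.PropositionalEquality using (_≡_)
open import Algebra.Bundles using (CommutativeRing)

-- Graphs on vertex set Fin n, given by their adjacency matrix over
-- GF(2) = Bool (true = 1).  G v v ≡ true iff v is looped.

Graph : ℕ → Set
Graph n = Fin n → Fin n → Bool

SymmetricGraph : ∀ {n} → Graph n → Set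
SymmetricGraph G = ∀ u v → G u v ≡ G v u

Sub : ℕ → Set
Sub n = Fin n → Bool

cons : ∀ {n} → Bool → Sub n → Sub (suc n)
cons b s zero    = b
cons b s (suc i) = s i

subsets : ∀ n → List (Sub n)
subsets zero    = (λ ()) ∷ []
subsets (suc n) = concatMap (λ s → cons false s ∷ cons true s ∷ []) (subsets n)

allFinᵇ : ∀ {n} → (Fin n → Bool) → Bool
allFinᵇ {zero}  f = true
allFinᵇ {suc n} f = f zero ∧ allFinᵇ (λ i → f (suc i))

anyFinᵇ : ∀ {n} → (Fin n → Bool) → Bool
anyFinᵇ {zero}  f = false
anyFinᵇ {suc n} f = f zero ∨ anyFinᵇ (λ i → f (suc i))

xorSum : ∀ {n} → (Fin n → Bool) → Bool
xorSum {zero}  f = false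
xorSum {suc n} f = f zero xor xorSum (λ i → f (suc i))

card : ∀ {n} → Sub n → ℕ
card {zero}  s = 0
card {suc n} s = (if s zero then 1 else 0) Data.Nat.+ card (λ i → s (suc i))

_⊆ᵇ_ : ∀ {n} → Sub n → Sub n → Bool
U ⊆ᵇ T = allFinᵇ (λ i → not (U i) ∨ T i)

nonemptyᵇ : ∀ {n} → Sub n → Bool
nonemptyᵇ U = anyFinᵇ U

-- Rank over GF(2) of the adjacency matrix of the induced subgraph G[S]
-- (the principal submatrix of G with rows and columns in S).
--
-- Row u of G[S] (u ∈ S) is the vector  v ↦ G u v  restricted to v ∈ S.
-- A family of rows indexed by T ⊆ S is linearly independent over GF(2)
-- iff no nonempty subfamily U ⊆ T sums to the zero vector.
-- The rank is the maximal size of a linearly independent family of rows.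

rowSum : ∀ {n} → Graph n → Sub n → Sub n → Fin n → Bool
rowSum G S U v = S v ∧ xorSum (λ u → U u ∧ G u v)

allListᵇ : ∀ {A : Set} → (A → Bool) → List A → Bool
allListᵇ p []       = true
allListᵇ p (z ∷ zs) = p z ∧ allListᵇ p zs

independentᵇ : ∀ {n} → Graph n → Sub n → Sub n → Bool
independentᵇ {n} G S T =
  allListᵇ (λ U → not (U ⊆ᵇ T ∧ nonemptyᵇ U) ∨ anyFinᵇ (rowSum G S U)) (subsets n)

rank : ∀ {n} → Graph n → Sub n → ℕ
rank {n} G S =
  foldr (λ T m → (if (T ⊆ᵇ S) ∧ independentᵇ G S T then card T else 0) ⊔ m)
        0 (subsets n)

nullity : ∀ {n} → Graph n → Sub n → ℕ
nullity G S = card S ∸ rank G S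

_==_ : ∀ {n} → Fin n → Fin n → Bool
i == j = does (i ≟ j)

localComp : ∀ {n} → Fin n → Graph n → Graph n
localComp a G u w =
  G u w xor (not (u == a) ∧ not (w == a) ∧ G a u ∧ G a w)

pivot : ∀ {n} → Fin n → Fin n → Graph n → Graph n
pivot a b G u w = G u w xor (C u w ∨ C w u)
  where
  out : _ → Bool
  out z = not (z == a) ∧ not (z == b)
  C : _ → _ → Bool
  C s t = out s ∧ out t ∧ G s a ∧ G t b ∧ (not (G s b) ∨ not (G t a))

-- vertex deletion G - a (the remaining vertices are renumbered by punchIn a)
delete : ∀ {n} → Fin (suc n) → Graph (suc n) → Graph n
delete a G u v = G (punchIn a u) (punchIn a v)

module _ {c ℓ} (R : CommutativeRing c ℓ) where
  open CommutativeRing R using (Carrier; _+_; _*_; _-_; 0#; 1#)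

  pow : Carrier → ℕ → Carrier
  pow z zero    = 1#
  pow z (suc k) = z * pow z k

  prodFin : ∀ {n} → (Fin n → Carrier) → Carrier
  prodFin {zero}  f = 1#
  prodFin {suc n} f = f zero * prodFin (λ i → f (suc i))

  sumList : ∀ {n} → List (Sub n) → (Sub n → Carrier) → Carrier
  sumList []       f = 0#
  sumList (S ∷ Ss) f = f S + sumList Ss f

  q : (x y : Carrier) → ∀ {n} → (α β : Fin n → Carrier) → Graph n → Carrier
  q x y {n} α β G =
    sumList (subsets n) (λ S →
      prodFin (λ v → if S v then α v else β v)
      * pow (x - 1#) (rank G S)
      * pow (y - 1#) (nullity G S))

-- Split the sum defining q according to whether a (and b) lies in S. The subsets avoiding a give
-- q(G - a); for the others the GF(2) rank of G[S] is computed by Gaussian elimination. If a ∈ S is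
-- looped, clearing row and column a by elementary operations leaves the block sum of the 1×1 matrix
-- (1) and the Schur complement of G a a, which on S - a is the local complement G^a; so the rank drops
-- by one together with the size and the nullity is unchanged, giving (a). If ab is an edge between
-- unlooped vertices, the same elimination gives r(G[S]) = r(G^ab[S]) when a ∈ S, b ∉ S and
-- r(G[S]) = 2 + r(G^ab[S - a - b]) when a, b ∈ S; comparing with the expansion of q(G^ab - b) at a
-- gives (b). Without non-loop edges every vertex is a 1×1 block and q factorises, which is (c).
-- Because the rank is defined as the size of a largest independent set of rows, its invariance
-- under row operations needs a Steinitz exchange argument.

module Submission where

open import Defs
open import Data.Nat using (ℕ; suc)
open import Data.Bool using (true; false; if_then_else_)
open import Data.Fin using (Fin; punchIn; punchOut)
open import Data.Product using (_×_; _,_)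
open import Relation.Binary.PropositionalEquality using (_≡_; _≢_)
open import Algebra.Bundles using (CommutativeRing)

module Rank where

  open import Data.Nat using (zero; _+_; _≤_; _⊔_; z≤n; s≤s)
  open import Data.Nat.Properties
    using (+-comm; +-assoc; +-identityʳ; +-cancelʳ-≡; +-monoʳ-≤; ⊔-sel; m≤m⊔n; m≤n⇒m≤o⊔n;
           ≤-antisym; ≤-trans; ≤-refl; ≤-reflexive; n≤1+n)
  open import Data.Bool using (Bool; _∧_; _∨_; not; _xor_)
  open import Data.Bool.Properties
    using (¬-not; xor-assoc; xor-comm; xor-same; xor-identityʳ; ∧-zeroʳ; ∧-identityʳ;
           ∧-distribˡ-xor; ∧-distribʳ-xor)
  open import Data.Bool.Solver using (module xor-∧-Solver)
  open import Data.Fin using (zero; suc; _≟_)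
  open import Data.Fin.Properties using (punchInᵢ≢i; punchIn-punchOut; punchIn-injective)
  open import Data.List using (List; []; _∷_; concatMap; foldr)
  open import Data.List.Relation.Unary.Any using (here; there)
  open import Data.List.Membership.Propositional using (_∈_)
  open import Data.List.Membership.Propositional.Properties using (∈-++⁺ˡ; ∈-++⁺ʳ)
  open import Data.Product using (∃; proj₁; proj₂)
  open import Data.Sum using (_⊎_; inj₁; inj₂)
  open import Data.Empty using (⊥-elim)
  open import Function using (_∘_)
  open import Relation.Binary.PropositionalEquality
  open import Relation.Nullary using (Dec; yes; no)
  open import Relation.Nullary.Decidable using (dec-true; dec-false)

  ≡true⇒≢false : ∀ {b} → b ≡ true → b ≢ false
  ≡true⇒≢false refl ()

  ∧-true : ∀ a {b} → a ∧ b ≡ true → a ≡ true × b ≡ true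
  ∧-true true eq = refl , eq

  xor-cancelʳ : ∀ p q → (p xor q) xor q ≡ p
  xor-cancelʳ p q = trans (xor-assoc p q q) (trans (cong (p xor_) (xor-same q)) (xor-identityʳ p))

  ==-refl : ∀ {n} (i : Fin n) → (i == i) ≡ true
  ==-refl i = dec-true (i ≟ i) refl

  ==-≢ : ∀ {n} {i j : Fin n} → i ≢ j → (i == j) ≡ false
  ==-≢ {i = i} {j} = dec-false (i ≟ j)

  ==⇒≡ : ∀ {n} {i j : Fin n} → (i == j) ≡ true → i ≡ j
  ==⇒≡ {i = i} {j} eq with i ≟ j
  ... | yes i≡j = i≡j

  punchIn-or-equal : ∀ {n} (a v : Fin (suc n)) → v ≡ a ⊎ ∃ λ j → v ≡ punchIn a j
  punchIn-or-equal a v with a ≟ v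
  ... | yes a≡v = inj₁ (sym a≡v)
  ... | no  a≢v = inj₂ (punchOut a≢v , sym (punchIn-punchOut a≢v))

  ≗-by-punchIn : ∀ {n} {X : Set} (a : Fin (suc n)) {f g : Fin (suc n) → X} →
    f a ≡ g a → (∀ i → f (punchIn a i) ≡ g (punchIn a i)) → f ≗ g
  ≗-by-punchIn a {f} {g} at-a elsewhere v with punchIn-or-equal a v
  ... | inj₁ refl       = at-a
  ... | inj₂ (j , refl) = elsewhere j

  allFinᵇ-sound : ∀ {n} (f : Fin n → Bool) → allFinᵇ f ≡ true → ∀ i → f i ≡ true
  allFinᵇ-sound {suc n} f eq zero    = proj₁ (∧-true (f zero) eq)
  allFinᵇ-sound {suc n} f eq (suc i) = allFinᵇ-sound (λ i → f (suc i)) (proj₂ (∧-true (f zero) eq)) i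

  allFinᵇ-complete : ∀ {n} (f : Fin n → Bool) → (∀ i → f i ≡ true) → allFinᵇ f ≡ true
  allFinᵇ-complete {zero}  f h = refl
  allFinᵇ-complete {suc n} f h rewrite h zero = allFinᵇ-complete (λ i → f (suc i)) (λ i → h (suc i))

  anyFinᵇ-sound : ∀ {n} (f : Fin n → Bool) → anyFinᵇ f ≡ true → ∃ λ i → f i ≡ true
  anyFinᵇ-sound {suc n} f eq with f zero in e
  ... | true  = zero , e
  ... | false = let i , fi = anyFinᵇ-sound (λ i → f (suc i)) eq in suc i , fi

  anyFinᵇ-complete : ∀ {n} (f : Fin n → Bool) i → f i ≡ true → anyFinᵇ f ≡ true
  anyFinᵇ-complete {suc n} f zero    fi rewrite fi = refl
  anyFinᵇ-complete {suc n} f (suc i) fi with f zero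
  ... | true  = refl
  ... | false = anyFinᵇ-complete (λ i → f (suc i)) i fi

  anyFinᵇ-false : ∀ {n} (f : Fin n → Bool) → anyFinᵇ f ≡ false → ∀ i → f i ≡ false
  anyFinᵇ-false {suc n} f eq i with f zero in e
  anyFinᵇ-false {suc n} f eq zero    | false = e
  anyFinᵇ-false {suc n} f eq (suc i) | false = anyFinᵇ-false (λ i → f (suc i)) eq i

  xorSum-true : ∀ {n} (f : Fin n → Bool) → xorSum f ≡ true → ∃ λ i → f i ≡ true
  xorSum-true {suc n} f eq with f zero in e
  ... | true  = zero , e
  ... | false = let i , fi = xorSum-true (λ i → f (suc i)) eq in suc i , fi

  xorSum-cong : ∀ {n} {f g : Fin n → Bool} → f ≗ g → xorSum f ≡ xorSum g
  xorSum-cong {zero}  h = refl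
  xorSum-cong {suc n} h = cong₂ _xor_ (h zero) (xorSum-cong (λ i → h (suc i)))

  xorSum-false : ∀ {n} (f : Fin n → Bool) → (∀ i → f i ≡ false) → xorSum f ≡ false
  xorSum-false {zero}  f h = refl
  xorSum-false {suc n} f h rewrite h zero = xorSum-false (λ i → f (suc i)) (λ i → h (suc i))

  xorSum-xor : ∀ {n} (f g : Fin n → Bool) → xorSum (λ i → f i xor g i) ≡ xorSum f xor xorSum g
  xorSum-xor {zero}  f g = refl
  xorSum-xor {suc n} f g =
    trans (cong ((f zero xor g zero) xor_) (xorSum-xor (λ i → f (suc i)) (λ i → g (suc i))))
          (interchange (f zero) (g zero) _ _)
    where
    open xor-∧-Solver
    interchange : ∀ a b c d → (a xor b) xor (c xor d) ≡ (a xor c) xor (b xor d)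
    interchange = solve 4 (λ a b c d → (a :+ b) :+ (c :+ d) := (a :+ c) :+ (b :+ d)) refl

  xorSum-∧ˡ : ∀ {n} b (f : Fin n → Bool) → xorSum (λ i → b ∧ f i) ≡ b ∧ xorSum f
  xorSum-∧ˡ true  f = refl
  xorSum-∧ˡ {n} false f = xorSum-false {n} _ (λ _ → refl)

  xorSum-punchIn : ∀ {n} (a : Fin (suc n)) (f : Fin (suc n) → Bool) →
    xorSum f ≡ f a xor xorSum (λ i → f (punchIn a i))
  xorSum-punchIn zero f = refl
  xorSum-punchIn {suc n} (suc a) f =
    trans (cong (f zero xor_) (xorSum-punchIn a (λ i → f (suc i))))
          (trans (sym (xor-assoc (f zero) (f (suc a)) rest))
          (trans (cong (_xor rest) (xor-comm (f zero) (f (suc a))))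
                 (xor-assoc (f (suc a)) (f zero) rest)))
    where
    rest = xorSum (λ i → f (suc (punchIn a i)))

  _⊆_ : ∀ {n} → Sub n → Sub n → Set
  U ⊆ T = ∀ i → U i ≡ true → T i ≡ true

  Nonempty : ∀ {n} → Sub n → Set
  Nonempty U = ∃ λ i → U i ≡ true

  ⊆⇒∉ : ∀ {n} {U T : Sub n} → U ⊆ T → ∀ i → T i ≡ false → U i ≡ false
  ⊆⇒∉ U⊆T i Ti≡false = ¬-not λ Ui≡true → ≡true⇒≢false (U⊆T i Ui≡true) Ti≡false

  bit : Bool → ℕ
  bit b = if b then 1 else 0

  card-cong : ∀ {n} {s t : Sub n} → s ≗ t → card s ≡ card t
  card-cong {zero}  h = refl
  card-cong {suc n} h = cong₂ (λ b m → bit b + m) (h zero) (card-cong (λ i → h (suc i)))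

  card-punchIn : ∀ {n} (a : Fin (suc n)) (s : Sub (suc n)) →
    card s ≡ bit (s a) + card (λ i → s (punchIn a i))
  card-punchIn zero s = refl
  card-punchIn {suc n} (suc a) s =
    trans (cong (bit (s zero) +_) (card-punchIn a (λ i → s (suc i))))
          (trans (sym (+-assoc (bit (s zero)) (bit (s (suc a))) rest))
          (trans (cong (_+ rest) (+-comm (bit (s zero)) (bit (s (suc a)))))
                 (+-assoc (bit (s (suc a))) (bit (s zero)) rest)))
    where
    rest = card (λ i → s (suc (punchIn a i)))

  insert : ∀ {n} → Fin (suc n) → Bool → Sub n → Sub (suc n)
  insert zero    b s = cons b s
  insert {suc n} (suc a) b s = cons (s zero) (insert a b (λ i → s (suc i)))

  insert-at : ∀ {n} (a : Fin (suc n)) b (s : Sub n) → insert a b s a ≡ b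
  insert-at zero    b s = refl
  insert-at {suc n} (suc a) b s = insert-at a b _

  insert-punchIn : ∀ {n} (a : Fin (suc n)) b (s : Sub n) i → insert a b s (punchIn a i) ≡ s i
  insert-punchIn zero    b s i = refl
  insert-punchIn {suc n} (suc a) b s zero    = refl
  insert-punchIn {suc n} (suc a) b s (suc i) = insert-punchIn a b _ i

  card-insert : ∀ {n} (a : Fin (suc n)) b (s : Sub n) → card (insert a b s) ≡ bit b + card s
  card-insert a b s = trans (card-punchIn a (insert a b s))
    (cong₂ (λ c m → bit c + m) (insert-at a b s) (card-cong (insert-punchIn a b s)))

  insert-false-∌ : ∀ {n} (a : Fin (suc n)) (s : Sub n) v → insert a false s v ≡ true → v ≢ a
  insert-false-∌ a s v v∈ refl = ≡true⇒≢false v∈ (insert-at a false s)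

  _[_]≔_ : ∀ {n} → Sub n → Fin n → Bool → Sub n
  (S [ a ]≔ b) v = if v == a then b else S v

  []≔-at : ∀ {n} (S : Sub n) a b → (S [ a ]≔ b) a ≡ b
  []≔-at S a b rewrite ==-refl a = refl

  []≔-other : ∀ {n} (S : Sub n) a b v → v ≢ a → (S [ a ]≔ b) v ≡ S v
  []≔-other S a b v v≢a rewrite ==-≢ v≢a = refl

  []≔-true-⊇ : ∀ {n} (S : Sub n) a → S ⊆ (S [ a ]≔ true)
  []≔-true-⊇ S a v Sv with v == a
  ... | true  = refl
  ... | false = Sv

  ==-false⇒≢ : ∀ {n} {i j : Fin n} → (i == j) ≡ false → i ≢ j
  ==-false⇒≢ {i = i} eq refl = ≡true⇒≢false (==-refl i) eq

  ⊆-trans : ∀ {n} {A B C : Sub n} → A ⊆ B → B ⊆ C → A ⊆ C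
  ⊆-trans A⊆B B⊆C i Ai = B⊆C i (A⊆B i Ai)

  []≔-false-⊆ : ∀ {n} (T : Sub n) a → (T [ a ]≔ false) ⊆ T
  []≔-false-⊆ T a i Ti with i == a
  ... | false = Ti

  []≔-true-mono : ∀ {n} {T S : Sub n} a b → T ⊆ S → (T [ a ]≔ b) ⊆ (S [ a ]≔ true)
  []≔-true-mono a b T⊆S i Ti with i == a
  ... | true  = refl
  ... | false = T⊆S i Ti

  ⊆-[]≔ : ∀ {n} {U T : Sub n} a b → U ⊆ (T [ a ]≔ b) → U a ≡ false → U ⊆ T
  ⊆-[]≔ {U = U} {T} a b U⊆ Ua i Ui with i == a in i≟a
  ... | true  = ⊥-elim (≡true⇒≢false (subst (λ j → U j ≡ true) (==⇒≡ i≟a) Ui) Ua)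
  ... | false = trans (sym ([]≔-other T a b i (==-false⇒≢ i≟a))) (U⊆ i Ui)

  insert≗[]≔ : ∀ {n} (a : Fin (suc n)) b (s : Sub n) → insert a b s ≗ (insert a false s [ a ]≔ b)
  insert≗[]≔ a b s = ≗-by-punchIn a
    (trans (insert-at a b s) (sym ([]≔-at (insert a false s) a b)))
    (λ i → trans (insert-punchIn a b s i)
      (sym (trans ([]≔-other (insert a false s) a b (punchIn a i) (punchInᵢ≢i a i))
                  (insert-punchIn a false s i))))

  card-[]≔ : ∀ {n} (S : Sub n) a b → card (S [ a ]≔ b) + bit (S a) ≡ card S + bit b
  card-[]≔ {suc n} S a b =
    begin
      card (S [ a ]≔ b) + bit (S a)
    ≡⟨ cong (_+ bit (S a)) (card-punchIn a (S [ a ]≔ b)) ⟩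
      (bit ((S [ a ]≔ b) a) + card (λ i → (S [ a ]≔ b) (punchIn a i))) + bit (S a)
    ≡⟨ cong₂ (λ c m → (bit c + m) + bit (S a)) ([]≔-at S a b)
         (card-cong (λ i → []≔-other S a b (punchIn a i) (punchInᵢ≢i a i))) ⟩
      (bit b + rest) + bit (S a)
    ≡⟨ swap-outer (bit b) rest (bit (S a)) ⟩
      (bit (S a) + rest) + bit b
    ≡⟨ cong (_+ bit b) (sym (card-punchIn a S)) ⟩
      card S + bit b
    ∎
    where
    open ≡-Reasoning
    rest = card (λ i → S (punchIn a i))
    swap-outer : ∀ p q r → (p + q) + r ≡ (r + q) + p
    swap-outer p q r = trans (+-comm (p + q) r) (trans (sym (+-assoc r p q))
      (trans (cong (_+ q) (+-comm r p)) (trans (+-assoc p r q) (+-comm p (r + q)))))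

  ∈-concatMap : ∀ {A B : Set} (f : A → List B) {x : A} {y : B} {L : List A} →
    x ∈ L → y ∈ f x → y ∈ concatMap f L
  ∈-concatMap f {L = _ ∷ L} (here refl) y∈fx = ∈-++⁺ˡ y∈fx
  ∈-concatMap f {L = z ∷ L} (there x∈L) y∈fx = ∈-++⁺ʳ (f z) (∈-concatMap f x∈L y∈fx)

  subsets-complete : ∀ n (U : Sub n) → ∃ λ U′ → U′ ∈ subsets n × U′ ≗ U
  subsets-complete zero    U = (λ ()) , here refl , (λ ())
  subsets-complete (suc n) U =
    let U′ , U′∈ , U′≗ = subsets-complete n (λ i → U (suc i))
    in cons (U zero) U′ , ∈-concatMap _ U′∈ (head∈ (U zero)) , extend U′≗
    where
    head∈ : ∀ b {t : Sub n} → cons b t ∈ (cons false t ∷ cons true t ∷ [])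
    head∈ false = here refl
    head∈ true  = there (here refl)
    extend : ∀ {t} → t ≗ (λ i → U (suc i)) → cons (U zero) t ≗ U
    extend t≗ zero    = refl
    extend t≗ (suc i) = t≗ i

  allListᵇ-sound : ∀ {A : Set} (p : A → Bool) (L : List A) {x} → allListᵇ p L ≡ true → x ∈ L → p x ≡ true
  allListᵇ-sound p (y ∷ L) eq (here refl) = proj₁ (∧-true (p y) eq)
  allListᵇ-sound p (y ∷ L) eq (there x∈L) = allListᵇ-sound p L (proj₂ (∧-true (p y) eq)) x∈L

  allListᵇ-complete : ∀ {A : Set} (p : A → Bool) (L : List A) → (∀ x → p x ≡ true) → allListᵇ p L ≡ true
  allListᵇ-complete p []      h = refl
  allListᵇ-complete p (y ∷ L) h rewrite h y = allListᵇ-complete p L h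

  allListᵇ-false : ∀ {A : Set} (p : A → Bool) (L : List A) → allListᵇ p L ≡ false → ∃ λ x → p x ≡ false
  allListᵇ-false p (y ∷ L) eq with p y in e
  ... | false = y , e
  ... | true  = allListᵇ-false p L eq

  ⊆ᵇ-sound : ∀ {n} (U T : Sub n) → (U ⊆ᵇ T) ≡ true → U ⊆ T
  ⊆ᵇ-sound U T eq i Ui with allFinᵇ-sound _ eq i
  ... | ok rewrite Ui = ok

  ⊆ᵇ-complete : ∀ {n} (U T : Sub n) → U ⊆ T → (U ⊆ᵇ T) ≡ true
  ⊆ᵇ-complete U T U⊆T = allFinᵇ-complete _ member
    where
    member : ∀ i → (not (U i) ∨ T i) ≡ true
    member i with U i in e
    ... | true  = U⊆T i e
    ... | false = refl

  Independent : ∀ {n} → Graph n → Sub n → Sub n → Set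
  Independent G S T = ∀ U → U ⊆ T → Nonempty U → ∃ λ v → rowSum G S U v ≡ true

  rowSum-cong : ∀ {n} (G : Graph n) S {U U′} → U ≗ U′ → ∀ v → rowSum G S U v ≡ rowSum G S U′ v
  rowSum-cong G S U≗U′ v = cong (S v ∧_) (xorSum-cong (λ u → cong (_∧ G u v) (U≗U′ u)))

  independentᵇ-sound : ∀ {n} (G : Graph n) S T → independentᵇ G S T ≡ true → Independent G S T
  independentᵇ-sound {n} G S T eq U U⊆T (i , Ui) =
    let U′ , U′∈ , U′≗U = subsets-complete n U
        U′⊆T = ⊆ᵇ-complete U′ T (λ j U′j → U⊆T j (trans (sym (U′≗U j)) U′j))
        U′≢∅ = anyFinᵇ-complete U′ i (trans (U′≗U i) Ui)
        clause = allListᵇ-sound _ (subsets n) eq U′∈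
        v , v∈ = anyFinᵇ-sound (rowSum G S U′) (witness clause U′⊆T U′≢∅)
    in v , trans (rowSum-cong G S (λ j → sym (U′≗U j)) v) v∈
    where
    witness : ∀ {p q r} → (not (p ∧ q) ∨ r) ≡ true → p ≡ true → q ≡ true → r ≡ true
    witness clause refl refl = clause

  independentᵇ-complete : ∀ {n} (G : Graph n) S T → Independent G S T → independentᵇ G S T ≡ true
  independentᵇ-complete {n} G S T ind = allListᵇ-complete _ (subsets n) clause
    where
    clause : ∀ U → (not ((U ⊆ᵇ T) ∧ nonemptyᵇ U) ∨ anyFinᵇ (rowSum G S U)) ≡ true
    clause U with U ⊆ᵇ T in U⊆T | nonemptyᵇ U in U≢∅
    ... | false | _     = refl
    ... | true  | false = refl
    ... | true  | true  =
      let v , v∈ = ind U (⊆ᵇ-sound U T U⊆T) (anyFinᵇ-sound U U≢∅)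
      in anyFinᵇ-complete _ v v∈

  independentᵇ-false : ∀ {n} (G : Graph n) S T → independentᵇ G S T ≡ false →
    ∃ λ U → U ⊆ T × Nonempty U × (∀ v → rowSum G S U v ≡ false)
  independentᵇ-false {n} G S T eq with allListᵇ-false _ (subsets n) eq
  ... | U , clause with U ⊆ᵇ T in U⊆T | nonemptyᵇ U in U≢∅
  ... | true | true =
    U , ⊆ᵇ-sound U T U⊆T , anyFinᵇ-sound U U≢∅ , anyFinᵇ-false (rowSum G S U) clause

  ∅-independent : ∀ {n} (G : Graph n) S → Independent G S (λ _ → false)
  ∅-independent G S U U⊆∅ (i , Ui) with U⊆∅ i Ui
  ... | ()

  private
    module Maximum {n} (f : Sub n → ℕ) where
      maximum : List (Sub n) → ℕ
      maximum = foldr (λ T m → f T ⊔ m) 0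

      ≤-maximum : ∀ {x} L → x ∈ L → f x ≤ maximum L
      ≤-maximum (y ∷ L) (here refl) = m≤m⊔n (f y) (maximum L)
      ≤-maximum (y ∷ L) (there x∈L) = m≤n⇒m≤o⊔n (f y) (≤-maximum L x∈L)

      maximum-attained : ∀ L → maximum L ≡ 0 ⊎ ∃ λ x → maximum L ≡ f x
      maximum-attained []      = inj₁ refl
      maximum-attained (y ∷ L) with ⊔-sel (f y) (maximum L) | maximum-attained L
      ... | inj₁ eq | _              = inj₂ (y , eq)
      ... | inj₂ eq | inj₁ eq′       = inj₁ (trans eq eq′)
      ... | inj₂ eq | inj₂ (x , eq′) = inj₂ (x , trans eq eq′)

  rankTerm : ∀ {n} → Graph n → Sub n → Sub n → ℕ
  rankTerm G S T = if (T ⊆ᵇ S) ∧ independentᵇ G S T then card T else 0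

  card≤rank : ∀ {n} (G : Graph n) S T → T ⊆ S → Independent G S T → card T ≤ rank G S
  card≤rank {n} G S T T⊆S ind =
    let T′ , T′∈ , T′≗T = subsets-complete n T
        T′⊆S = ⊆ᵇ-complete T′ S (λ i T′i → T⊆S i (trans (sym (T′≗T i)) T′i))
        T′-ind = independentᵇ-complete G S T′ (λ U U⊆T′ → ind U (λ i Ui → trans (sym (T′≗T i)) (U⊆T′ i Ui)))
    in ≤-trans (≤-reflexive (sym (trans (term T′⊆S T′-ind) (card-cong T′≗T))))
               (Maximum.≤-maximum (rankTerm G S) (subsets n) T′∈)
    where
    term : ∀ {T′} → (T′ ⊆ᵇ S) ≡ true → independentᵇ G S T′ ≡ true → rankTerm G S T′ ≡ card T′
    term p q rewrite p | q = refl

  card-∅ : ∀ {n} → card {n} (λ _ → false) ≡ 0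
  card-∅ {zero}  = refl
  card-∅ {suc n} = card-∅ {n}

  RankWitness : ∀ {n} → Graph n → Sub n → Set
  RankWitness G S = ∃ λ T → T ⊆ S × Independent G S T × card T ≡ rank G S

  ∅-witnesses-rank-0 : ∀ {n} (G : Graph n) S → rank G S ≡ 0 → RankWitness G S
  ∅-witnesses-rank-0 {n} G S eq = (λ _ → false) , (λ i ()) , ∅-independent G S , trans (card-∅ {n}) (sym eq)

  rank-attained : ∀ {n} (G : Graph n) S → RankWitness G S
  rank-attained {n} G S with Maximum.maximum-attained (rankTerm G S) (subsets n)
  ... | inj₁ eq       = ∅-witnesses-rank-0 G S eq
  ... | inj₂ (T , eq) with T ⊆ᵇ S in T⊆S | independentᵇ G S T in T-ind
  ...   | true  | true  = T , ⊆ᵇ-sound T S T⊆S , independentᵇ-sound G S T T-ind , sym eq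
  ...   | true  | false = ∅-witnesses-rank-0 G S eq
  ...   | false | _     = ∅-witnesses-rank-0 G S eq

  card-mono : ∀ {n} {T S : Sub n} → T ⊆ S → card T ≤ card S
  card-mono {zero}          T⊆S = z≤n
  card-mono {suc n} {T} {S} T⊆S with T zero in T0
  ... | true rewrite T⊆S zero T0 = s≤s (card-mono (λ i → T⊆S (suc i)))
  ... | false = ≤-trans (card-mono (λ i → T⊆S (suc i))) (≤-bit+ (S zero))
    where
    ≤-bit+ : ∀ b {m} → m ≤ bit b + m
    ≤-bit+ true  = n≤1+n _
    ≤-bit+ false = ≤-refl

  rank≤card : ∀ {n} (G : Graph n) S → rank G S ≤ card S
  rank≤card G S =
    let T , T⊆S , _ , cardT≡rank = rank-attained G S
    in ≤-trans (≤-reflexive (sym cardT≡rank)) (card-mono T⊆S)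

  IndependentMap : ∀ {n m} → Graph n → Sub n → Graph m → Sub m → (ℕ → ℕ → Set) → Set
  IndependentMap G S G′ S′ _≲_ =
    ∀ T → T ⊆ S → Independent G S T → ∃ λ T′ → T′ ⊆ S′ × Independent G′ S′ T′ × card T ≲ card T′

  rank-≡-offset : ∀ {n m} (G : Graph n) S (G′ : Graph m) S′ k →
    IndependentMap G S G′ S′ (λ c c′ → c ≤ k + c′) → IndependentMap G′ S′ G S (λ c′ c → k + c′ ≤ c) →
    rank G S ≡ k + rank G′ S′
  rank-≡-offset G S G′ S′ k forth back =
    let T  , T⊆S   , T-ind  , cardT  = rank-attained G S
        T′ , T′⊆S′ , T′-ind , cardT′ = rank-attained G′ S′
        U′ , U′⊆S′ , U′-ind , T≤U′   = forth T T⊆S T-ind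
        U  , U⊆S   , U-ind  , T′≤U   = back T′ T′⊆S′ T′-ind
    in ≤-antisym
         (≤-trans (≤-reflexive (sym cardT))
           (≤-trans T≤U′ (+-monoʳ-≤ k (card≤rank G′ S′ U′ U′⊆S′ U′-ind))))
         (≤-trans (≤-reflexive (cong (k +_) (sym cardT′)))
           (≤-trans T′≤U (card≤rank G S U U⊆S U-ind)))

  rank-≡ : ∀ {n} (G : Graph n) S (G′ : Graph n) S′ →
    (∀ T → T ⊆ S → T ⊆ S′ × (Independent G S T → Independent G′ S′ T)) →
    (∀ T → T ⊆ S′ → T ⊆ S × (Independent G′ S′ T → Independent G S T)) →
    rank G S ≡ rank G′ S′
  rank-≡ G S G′ S′ forth back = rank-≡-offset G S G′ S′ 0
    (λ T T⊆S ind → T , proj₁ (forth T T⊆S) , proj₂ (forth T T⊆S) ind , ≤-refl)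
    (λ T T⊆S′ ind → T , proj₁ (back T T⊆S′) , proj₂ (back T T⊆S′) ind , ≤-refl)

  rank-≡-rowSum : ∀ {n} (G G′ : Graph n) S →
    (∀ U → U ⊆ S → ∀ v → rowSum G S U v ≡ rowSum G′ S U v) → rank G S ≡ rank G′ S
  rank-≡-rowSum G G′ S same = rank-≡ G S G′ S
    (λ T T⊆S → T⊆S , λ ind U U⊆T U≢∅ →
       let v , v∈ = ind U U⊆T U≢∅ in v , trans (sym (same U (⊆-trans U⊆T T⊆S) v)) v∈)
    (λ T T⊆S → T⊆S , λ ind U U⊆T U≢∅ →
       let v , v∈ = ind U U⊆T U≢∅ in v , trans (same U (⊆-trans U⊆T T⊆S) v) v∈)

  rank-cong-sub : ∀ {n} (G : Graph n) {S S′} → S ≗ S′ → rank G S ≡ rank G S′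
  rank-cong-sub G {S} {S′} S≗S′ = rank-≡ G S G S′
    (λ T T⊆S → (λ i Ti → trans (sym (S≗S′ i)) (T⊆S i Ti)) ,
               λ ind U U⊆T U≢∅ → let v , v∈ = ind U U⊆T U≢∅ in v , trans (sym (same v)) v∈)
    (λ T T⊆S′ → (λ i Ti → trans (S≗S′ i) (T⊆S′ i Ti)) ,
                λ ind U U⊆T U≢∅ → let v , v∈ = ind U U⊆T U≢∅ in v , trans (same v) v∈)
    where
    same : ∀ {U} v → rowSum G S U v ≡ rowSum G S′ U v
    same v = cong (_∧ _) (S≗S′ v)

  rank-cong-graph : ∀ {n} (G G′ : Graph n) S →
    (∀ u v → S u ≡ true → S v ≡ true → G u v ≡ G′ u v) → rank G S ≡ rank G′ S
  rank-cong-graph G G′ S agree = rank-≡-rowSum G G′ S same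
    where
    same : ∀ U → U ⊆ S → ∀ v → rowSum G S U v ≡ rowSum G′ S U v
    same U U⊆S v with S v in Sv
    ... | false = refl
    ... | true  = xorSum-cong term
      where
      term : ∀ u → (U u ∧ G u v) ≡ (U u ∧ G′ u v)
      term u with U u in Uu
      ... | false = refl
      ... | true  = agree u v (U⊆S u Uu) Sv

  rowSum-xor : ∀ {n} (G : Graph n) S U V v →
    rowSum G S (λ i → U i xor V i) v ≡ rowSum G S U v xor rowSum G S V v
  rowSum-xor G S U V v =
    trans (cong (S v ∧_) (trans (xorSum-cong (λ u → ∧-distribʳ-xor (G u v) (U u) (V u)))
                                (xorSum-xor (λ u → U u ∧ G u v) (λ u → V u ∧ G u v))))
          (∧-distribˡ-xor (S v) _ _)

  rowSum-true-∈ : ∀ {n} (G : Graph n) S U v → rowSum G S U v ≡ true → S v ≡ true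
  rowSum-true-∈ G S U v eq with S v
  ... | true = refl

  rowSum-∈ : ∀ {n} (G : Graph n) S U v → S v ≡ true → rowSum G S U v ≡ xorSum (λ u → U u ∧ G u v)
  rowSum-∈ G S U v Sv rewrite Sv = refl

  rowSum-zero-column : ∀ {n} (G : Graph n) S U v → (∀ u → U u ≡ true → G u v ≡ false) →
    rowSum G S U v ≡ false
  rowSum-zero-column G S U v column = trans (cong (S v ∧_) (xorSum-false _ term)) (∧-zeroʳ (S v))
    where
    term : ∀ u → (U u ∧ G u v) ≡ false
    term u with U u in Uu
    ... | false = refl
    ... | true  = column u Uu

  rowSum-single : ∀ {n} (G : Graph (suc n)) S a v → rowSum G S (λ i → i == a) v ≡ S v ∧ G a v
  rowSum-single G S a v = cong (S v ∧_) (trans (xorSum-punchIn a (λ u → (u == a) ∧ G u v))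
    (trans (cong₂ _xor_ at-a (xorSum-false _ elsewhere)) (xor-identityʳ (G a v))))
    where
    at-a : ((a == a) ∧ G a v) ≡ G a v
    at-a rewrite ==-refl a = refl
    elsewhere : ∀ i → ((punchIn a i == a) ∧ G (punchIn a i) v) ≡ false
    elsewhere i rewrite ==-≢ (punchInᵢ≢i a i) = refl

  independent-cong : ∀ {n} (G : Graph n) S {T T′} → T ≗ T′ → Independent G S T → Independent G S T′
  independent-cong G S T≗T′ ind U U⊆T′ = ind U (λ i Ui → trans (T≗T′ i) (U⊆T′ i Ui))

  insert-restrict : ∀ {n} (a : Fin (suc n)) (T : Sub (suc n)) → T ≗ insert a (T a) (λ i → T (punchIn a i))
  insert-restrict a T = ≗-by-punchIn a (sym (insert-at a (T a) T′)) (λ i → sym (insert-punchIn a (T a) T′ i))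
    where
    T′ = λ i → T (punchIn a i)

  insert-false-restrict : ∀ {n} (a : Fin (suc n)) (T : Sub (suc n)) → T a ≡ false →
    T ≗ insert a false (λ i → T (punchIn a i))
  insert-false-restrict a T Ta v = trans (insert-restrict a T v) (cong (λ b → insert a b (λ i → T (punchIn a i)) v) Ta)

  insert-mono : ∀ {n} (a : Fin (suc n)) b {s t : Sub n} → s ⊆ t → insert a b s ⊆ insert a b t
  insert-mono a b {s} {t} s⊆t v v∈ with punchIn-or-equal a v
  ... | inj₁ refl       = trans (insert-at a b t) (trans (sym (insert-at a b s)) v∈)
  ... | inj₂ (j , refl) =
    trans (insert-punchIn a b t j) (s⊆t j (trans (sym (insert-punchIn a b s j)) v∈))

  restrict-mono : ∀ {n} (a : Fin (suc n)) b {T : Sub (suc n)} {s} → T ⊆ insert a b s →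
    (λ i → T (punchIn a i)) ⊆ s
  restrict-mono a b T⊆ i Ti = trans (sym (insert-punchIn a b _ i)) (T⊆ _ Ti)

  rowSum-delete : ∀ {n} (G : Graph (suc n)) a s U j →
    rowSum G (insert a false s) (insert a false U) (punchIn a j) ≡ rowSum (delete a G) s U j
  rowSum-delete G a s U j =
    cong₂ _∧_ (insert-punchIn a false s j)
      (trans (xorSum-punchIn a (λ u → insert a false U u ∧ G u (punchIn a j)))
         (cong₂ _xor_ (cong (_∧ G a (punchIn a j)) (insert-at a false U))
                      (xorSum-cong (λ i → cong (_∧ G (punchIn a i) (punchIn a j)) (insert-punchIn a false U i)))))

  independent-delete⁺ : ∀ {n} (G : Graph (suc n)) a s T →
    Independent G (insert a false s) (insert a false T) → Independent (delete a G) s T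
  independent-delete⁺ G a s T ind U U⊆T (i , Ui) =
    let v , v∈ = ind (insert a false U) (insert-mono a false U⊆T)
                     (punchIn a i , trans (insert-punchIn a false U i) Ui)
    in from-punchIn v v∈ (punchIn-or-equal a v)
    where
    S = insert a false s
    from-punchIn : ∀ v → rowSum G S (insert a false U) v ≡ true → v ≡ a ⊎ ∃ (λ j → v ≡ punchIn a j) →
      ∃ λ j → rowSum (delete a G) s U j ≡ true
    from-punchIn v v∈ (inj₁ v≡a) =
      ⊥-elim (insert-false-∌ a s v (rowSum-true-∈ G S (insert a false U) v v∈) v≡a)
    from-punchIn v v∈ (inj₂ (j , refl)) = j , trans (sym (rowSum-delete G a s U j)) v∈

  independent-delete⁻ : ∀ {n} (G : Graph (suc n)) a s T →
    Independent (delete a G) s T → Independent G (insert a false s) (insert a false T)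
  independent-delete⁻ G a s T ind U U⊆ (i , Ui) with punchIn-or-equal a i
  ... | inj₁ refl = ⊥-elim (≡true⇒≢false Ui Ua)
    where
    Ua = ⊆⇒∉ U⊆ a (insert-at a false T)
  ... | inj₂ (j , refl) =
    let w , w∈ = ind U′ (restrict-mono a false U⊆) (j , Ui)
    in punchIn a w , trans (rowSum-cong G (insert a false s) U≗ (punchIn a w)) (trans (rowSum-delete G a s U′ w) w∈)
    where
    U′ = λ k → U (punchIn a k)
    U≗ : U ≗ insert a false U′
    U≗ = insert-false-restrict a U (⊆⇒∉ U⊆ a (insert-at a false T))

  rank-delete : ∀ {n} (G : Graph (suc n)) a s → rank G (insert a false s) ≡ rank (delete a G) s
  rank-delete {n} G a s = rank-≡-offset G (insert a false s) (delete a G) s 0 forth back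
    where
    forth : IndependentMap G (insert a false s) (delete a G) s _≤_
    forth T T⊆ ind =
      T′ , restrict-mono a false T⊆ ,
      independent-delete⁺ G a s T′ (independent-cong G _ T≗ ind) ,
      ≤-reflexive (trans (card-cong T≗) (card-insert a false T′))
      where
      T′ = λ i → T (punchIn a i)
      T≗ : T ≗ insert a false T′
      T≗ = insert-false-restrict a T (⊆⇒∉ T⊆ a (insert-at a false s))
    back : IndependentMap (delete a G) s G (insert a false s) _≤_
    back T′ T′⊆s ind =
      insert a false T′ , insert-mono a false T′⊆s , independent-delete⁻ G a s T′ ind ,
      ≤-reflexive (sym (card-insert a false T′))

  -- Column operations

  colOp : ∀ {n} → Graph n → Fin n → Sub n → Graph n
  colOp G a z u v = G u v xor (z v ∧ G u a)

  rowSum-colOp : ∀ {n} (G : Graph n) S a z U v → S a ≡ true →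
    rowSum (colOp G a z) S U v ≡ rowSum G S U v xor ((S v ∧ z v) ∧ rowSum G S U a)
  rowSum-colOp G S a z U v Sa rewrite Sa =
    trans (cong (S v ∧_) (trans (xorSum-cong (λ u → distrib (U u) (G u v) (z v) (G u a)))
                         (trans (xorSum-xor (λ u → U u ∧ G u v) (λ u → z v ∧ (U u ∧ G u a)))
                                (cong (xorSum (λ u → U u ∧ G u v) xor_) (xorSum-∧ˡ (z v) (λ u → U u ∧ G u a))))))
          (distrib′ (S v) _ (z v) _)
    where
    open xor-∧-Solver
    distrib : ∀ p g z h → (p ∧ (g xor (z ∧ h))) ≡ (p ∧ g) xor (z ∧ (p ∧ h))
    distrib = solve 4 (λ p g z h → p :* (g :+ z :* h) := p :* g :+ z :* (p :* h)) refl
    distrib′ : ∀ s g z h → (s ∧ (g xor (z ∧ h))) ≡ (s ∧ g) xor ((s ∧ z) ∧ h)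
    distrib′ = solve 4 (λ s g z h → s :* (g :+ z :* h) := s :* g :+ (s :* z) :* h) refl

  shear-nonempty : ∀ {n} (r r′ c : Fin n → Bool) a → c a ≡ false →
    (∀ v → r′ v ≡ r v xor (c v ∧ r a)) → Nonempty r → Nonempty r′
  shear-nonempty r r′ c a ca shear (v , rv) = pick (r a) refl
    where
    pick : ∀ b → r a ≡ b → Nonempty r′
    pick true  ra = a , trans (shear a) (trans (cong (λ b → r a xor (b ∧ r a)) ca) (trans (xor-identityʳ (r a)) ra))
    pick false ra = v , trans (shear v) (trans (cong (λ b → r v xor (c v ∧ b)) ra)
                          (trans (cong (r v xor_) (∧-zeroʳ (c v))) (trans (xor-identityʳ (r v)) rv)))

  shear-inverse : ∀ {n} (r r′ c : Fin n → Bool) a → c a ≡ false →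
    (∀ v → r′ v ≡ r v xor (c v ∧ r a)) → ∀ v → r v ≡ r′ v xor (c v ∧ r′ a)
  shear-inverse r r′ c a ca shear v =
    begin
      r v
    ≡⟨ sym (xor-cancelʳ (r v) (c v ∧ r a)) ⟩
      (r v xor (c v ∧ r a)) xor (c v ∧ r a)
    ≡⟨ cong₂ (λ p q → p xor (c v ∧ q)) (sym (shear v)) (sym r′a≡ra) ⟩
      r′ v xor (c v ∧ r′ a)
    ∎
    where
    open ≡-Reasoning
    r′a≡ra : r′ a ≡ r a
    r′a≡ra = trans (shear a) (trans (cong (λ b → r a xor (b ∧ r a)) ca) (xor-identityʳ (r a)))

  rank-colOp : ∀ {n} (G : Graph n) S a z → S a ≡ true → z a ≡ false → rank (colOp G a z) S ≡ rank G S
  rank-colOp G S a z Sa za = rank-≡ (colOp G a z) S G S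
    (λ T T⊆S → T⊆S , λ ind U U⊆T U≢∅ → shear-nonempty _ _ c a ca (shear⁻¹ U) (ind U U⊆T U≢∅))
    (λ T T⊆S → T⊆S , λ ind U U⊆T U≢∅ → shear-nonempty _ _ c a ca (shear U) (ind U U⊆T U≢∅))
    where
    c : Fin _ → Bool
    c v = S v ∧ z v
    ca : c a ≡ false
    ca rewrite Sa = za
    shear : ∀ U v → rowSum (colOp G a z) S U v ≡ rowSum G S U v xor (c v ∧ rowSum G S U a)
    shear U v = rowSum-colOp G S a z U v Sa
    shear⁻¹ : ∀ U v → rowSum G S U v ≡ rowSum (colOp G a z) S U v xor (c v ∧ rowSum (colOp G a z) S U a)
    shear⁻¹ U = shear-inverse _ _ c a ca (shear U)

  -- A vertex with no edges into S splits off as a 1×1 block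

  module _ {n} (G : Graph (suc n)) (S : Sub (suc n)) (a : Fin (suc n)) (Sa : S a ≡ false)
           (column : ∀ u → S u ≡ true → G u a ≡ false) (row : ∀ v → S v ≡ true → G a v ≡ false) where

    private
      Sᵃ = S [ a ]≔ true

      rowSum-≢a : ∀ U v → v ≢ a → rowSum G Sᵃ U v ≡ rowSum G S U v
      rowSum-≢a U v v≢a = cong (_∧ _) ([]≔-other S a true v v≢a)

      loop-if-member : ∀ T → T ⊆ Sᵃ → Independent G Sᵃ T → T a ≡ true → G a a ≡ true
      loop-if-member T T⊆ ind Ta = ¬-not λ Gaa≡false →
        let v , v∈ = ind (λ i → i == a) (λ { i i≡a → subst (λ j → T j ≡ true) (sym (==⇒≡ i≡a)) Ta })
                         (a , ==-refl a)
        in ≡true⇒≢false v∈ (trans (rowSum-single G Sᵃ a v) (vanishes v Gaa≡false))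
        where
        vanishes : ∀ v → G a a ≡ false → (Sᵃ v ∧ G a v) ≡ false
        vanishes v Gaa with a ≟ v
        ... | yes refl = trans (cong (Sᵃ a ∧_) Gaa) (∧-zeroʳ _)
        ... | no  a≢v =
          trans (cong (_∧ G a v) ([]≔-other S a true v (λ v≡a → a≢v (sym v≡a)))) (off-S (S v) refl)
          where
          off-S : ∀ b → S v ≡ b → (b ∧ G a v) ≡ false
          off-S true  Sv = row v Sv
          off-S false _  = refl

    rank-isolated : rank G (S [ a ]≔ true) ≡ bit (G a a) + rank G S
    rank-isolated = rank-≡-offset G Sᵃ G S (bit (G a a)) forth back
      where
      forth : IndependentMap G Sᵃ G S (λ c c′ → c ≤ bit (G a a) + c′)
      forth T T⊆ ind = T′ , T′⊆S , T′-ind , card-bound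
        where
        T′ = T [ a ]≔ false
        T′⊆T : T′ ⊆ T
        T′⊆T = []≔-false-⊆ T a
        T′⊆S : T′ ⊆ S
        T′⊆S = ⊆-[]≔ a true (⊆-trans T′⊆T T⊆) ([]≔-at T a false)
        T′-ind : Independent G S T′
        T′-ind U U⊆T′ U≢∅ =
          let v , v∈ = ind U (λ i Ui → T′⊆T i (U⊆T′ i Ui)) U≢∅ in pick v v∈ (v ≟ a)
          where
          pick : ∀ v → rowSum G Sᵃ U v ≡ true → Dec (v ≡ a) → ∃ λ w → rowSum G S U w ≡ true
          pick v v∈ (yes refl) = ⊥-elim (≡true⇒≢false v∈
            (rowSum-zero-column G Sᵃ U a (λ u Uu → column u (T′⊆S u (U⊆T′ u Uu)))))
          pick v v∈ (no v≢a) = v , trans (sym (rowSum-≢a U v v≢a)) v∈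
        bit≤ : bit (T a) ≤ bit (G a a)
        bit≤ with T a in Ta
        ... | false = z≤n
        ... | true rewrite loop-if-member T T⊆ ind Ta = ≤-refl
        card-bound : card T ≤ bit (G a a) + card T′
        card-bound = ≤-trans (≤-reflexive (sym (trans (card-[]≔ T a false) (+-identityʳ (card T)))))
                       (≤-trans (+-monoʳ-≤ (card T′) bit≤)
                                (≤-reflexive (+-comm (card T′) (bit (G a a)))))
      back : IndependentMap G S G Sᵃ (λ c′ c → bit (G a a) + c′ ≤ c)
      back T′ T′⊆S ind = T′ [ a ]≔ G a a , T⊆ , T-ind , card-bound
        where
        T = T′ [ a ]≔ G a a
        T′a : T′ a ≡ false
        T′a = ⊆⇒∉ T′⊆S a Sa
        T⊆ : T ⊆ Sᵃ
        T⊆ = []≔-true-mono a (G a a) T′⊆S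
        T-ind : Independent G Sᵃ T
        T-ind U U⊆T U≢∅ with U a in Ua
        ... | true  = a , trans (rowSum-∈ G Sᵃ U a ([]≔-at S a true))
                        (trans (xorSum-punchIn a (λ u → U u ∧ G u a))
                        (cong₂ _xor_ (cong₂ _∧_ Ua Gaa) (xorSum-false _ off-diagonal)))
          where
          Gaa : G a a ≡ true
          Gaa = trans (sym ([]≔-at T′ a (G a a))) (U⊆T a Ua)
          off-diagonal : ∀ i → (U (punchIn a i) ∧ G (punchIn a i) a) ≡ false
          off-diagonal i with U (punchIn a i) in Ui
          ... | false = refl
          ... | true  = column _ (T′⊆S _ (trans (sym ([]≔-other T′ a _ _ (punchInᵢ≢i a i)))
                                                (U⊆T _ Ui)))
        ... | false =
          let v , v∈ = ind U U⊆T′ U≢∅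
              Sv = rowSum-true-∈ G S U v v∈
          in v , trans (cong (_∧ xorSum (λ u → U u ∧ G u v)) (trans ([]≔-true-⊇ S a v Sv) (sym Sv))) v∈
          where
          U⊆T′ : U ⊆ T′
          U⊆T′ = ⊆-[]≔ a (G a a) U⊆T Ua
        card-bound : bit (G a a) + card T′ ≤ card T
        card-bound = ≤-reflexive (trans (+-comm (bit (G a a)) (card T′)) (sym
          (trans (sym (+-identityʳ (card T))) (trans (cong (λ b → card T + bit b) (sym T′a))
                 (card-[]≔ T′ a (G a a))))))

  -- Row operations

  rowOp : ∀ {n} → Graph n → Fin n → Sub n → Graph n
  rowOp G a y u v = G u v xor (y u ∧ G a v)

  rowOp-involutive : ∀ {n} (G : Graph n) a y → y a ≡ false → ∀ u v → rowOp (rowOp G a y) a y u v ≡ G u v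
  rowOp-involutive G a y ya u v rewrite ya | xor-identityʳ (G a v) = xor-cancelʳ (G u v) (y u ∧ G a v)

  parity : ∀ {n} → Sub n → Sub n → Bool
  parity y U = xorSum (λ u → U u ∧ y u)

  rowOp-family : ∀ {n} → Sub n → Fin n → Sub n → Sub n
  rowOp-family y a U i = U i xor (parity y U ∧ (i == a))

  rowSum-rowOp : ∀ {n} (G : Graph (suc n)) S a y U v →
    rowSum (rowOp G a y) S U v ≡ rowSum G S (rowOp-family y a U) v
  rowSum-rowOp G S a y U v =
    begin
      S v ∧ xorSum (λ u → U u ∧ (G u v xor (y u ∧ G a v)))
    ≡⟨ cong (S v ∧_) (xorSum-cong (λ u → expand (U u) (G u v) (y u) (G a v))) ⟩
      S v ∧ xorSum (λ u → (U u ∧ G u v) xor (G a v ∧ (U u ∧ y u)))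
    ≡⟨ cong (S v ∧_) (trans (xorSum-xor (λ u → U u ∧ G u v) (λ u → G a v ∧ (U u ∧ y u)))
                            (cong (xorSum (λ u → U u ∧ G u v) xor_) (xorSum-∧ˡ (G a v) (λ u → U u ∧ y u)))) ⟩
      S v ∧ (xorSum (λ u → U u ∧ G u v) xor (G a v ∧ parity y U))
    ≡⟨ regroup (S v) (xorSum (λ u → U u ∧ G u v)) (G a v) (parity y U) ⟩
      rowSum G S U v xor (parity y U ∧ (S v ∧ G a v))
    ≡⟨ cong (λ r → rowSum G S U v xor (parity y U ∧ r)) (sym (rowSum-single G S a v)) ⟩
      rowSum G S U v xor (parity y U ∧ rowSum G S (λ i → i == a) v)
    ≡⟨ cong (rowSum G S U v xor_) (sym (rowSum-scale (parity y U))) ⟩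
      rowSum G S U v xor rowSum G S (λ i → parity y U ∧ (i == a)) v
    ≡⟨ sym (rowSum-xor G S U (λ i → parity y U ∧ (i == a)) v) ⟩
      rowSum G S (rowOp-family y a U) v
    ∎
    where
    open ≡-Reasoning
    open xor-∧-Solver
    expand : ∀ p g q h → (p ∧ (g xor (q ∧ h))) ≡ (p ∧ g) xor (h ∧ (p ∧ q))
    expand = solve 4 (λ p g q h → p :* (g :+ q :* h) := p :* g :+ h :* (p :* q)) refl
    regroup : ∀ s r h c → (s ∧ (r xor (h ∧ c))) ≡ (s ∧ r) xor (c ∧ (s ∧ h))
    regroup = solve 4 (λ s r h c → s :* (r :+ h :* c) := s :* r :+ c :* (s :* h)) refl
    rowSum-scale : ∀ c → rowSum G S (λ i → c ∧ (i == a)) v ≡ c ∧ rowSum G S (λ i → i == a) v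
    rowSum-scale true  = refl
    rowSum-scale false = trans (cong (S v ∧_) (xorSum-false (λ u → (false ∧ (u == a)) ∧ G u v) (λ _ → refl)))
                               (∧-zeroʳ (S v))

  module _ {n} (y : Sub n) (a : Fin n) where

    rowOp-family-≢ : ∀ U i → i ≢ a → rowOp-family y a U i ≡ U i
    rowOp-family-≢ U i i≢a rewrite ==-≢ i≢a = trans (cong (U i xor_) (∧-zeroʳ (parity y U))) (xor-identityʳ (U i))

    rowOp-family-even : ∀ U → parity y U ≡ false → rowOp-family y a U ≗ U
    rowOp-family-even U even i rewrite even = xor-identityʳ (U i)

    rowOp-family-nonempty : y a ≡ false → ∀ U → Nonempty U → Nonempty (rowOp-family y a U)
    rowOp-family-nonempty ya U (i , Ui) = pick (parity y U) refl
      where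
      pick : ∀ p → parity y U ≡ p → Nonempty (rowOp-family y a U)
      pick false even = i , trans (rowOp-family-even U even i) Ui
      pick true  odd  =
        let j , j∈ = xorSum-true (λ u → U u ∧ y u) odd
            Uj , yj = ∧-true (U j) j∈
        in j , trans (rowOp-family-≢ U j (λ { refl → ≡true⇒≢false yj ya })) Uj

    rowOp-family-⊆ : ∀ {U T} → U ⊆ T → T a ≡ true → rowOp-family y a U ⊆ T
    rowOp-family-⊆ {U} {T} U⊆T Ta i i∈ = pick (i ≟ a)
      where
      pick : Dec (i ≡ a) → T i ≡ true
      pick (yes refl) = Ta
      pick (no  i≢a)  = U⊆T i (trans (sym (rowOp-family-≢ U i i≢a)) i∈)

  module _ {n} (G : Graph (suc n)) (S : Sub (suc n)) (a : Fin (suc n)) (y : Sub (suc n))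
           (Sa : S a ≡ true) (ya : y a ≡ false) where

    private
      G′ = rowOp G a y

    independent-rowOp-∋ : ∀ T → T a ≡ true → Independent G S T → Independent G′ S T
    independent-rowOp-∋ T Ta ind U U⊆T U≢∅ =
      let v , v∈ = ind (rowOp-family y a U) (rowOp-family-⊆ y a U⊆T Ta) (rowOp-family-nonempty y a ya U U≢∅)
      in v , trans (rowSum-rowOp G S a y U v) v∈

    -- Steinitz exchange: if the rows U ⊆ T (with a ∉ T) become dependent in G′, trade a member of U for a.
    module Exchange (T : Sub (suc n)) (T⊆S : T ⊆ S) (ind : Independent G S T) (Ta : T a ≡ false)
                    (U : Sub (suc n)) (U⊆T : U ⊆ T) (U≢∅ : Nonempty U)
                    (dependent : ∀ v → rowSum G′ S U v ≡ false) where

      private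
        F = rowOp-family y a U
        u₀ = proj₁ U≢∅
        Uu₀ = proj₂ U≢∅

        F-dependent : ∀ v → rowSum G S F v ≡ false
        F-dependent v = trans (sym (rowSum-rowOp G S a y U v)) (dependent v)

        odd : parity y U ≡ true
        odd = ¬-not λ even →
          let v , v∈ = ind U U⊆T U≢∅
          in ≡true⇒≢false v∈ (trans (rowSum-cong G S (λ i → sym (rowOp-family-even y a U even i)) v)
                                    (F-dependent v))

        Ua : U a ≡ false
        Ua = ⊆⇒∉ U⊆T a Ta

        Fa : F a ≡ true
        Fa = trans (cong₂ (λ u p → u xor (p ∧ (a == a))) Ua odd) (==-refl a)

        u₀≢a : u₀ ≢ a
        u₀≢a u₀≡a = ≡true⇒≢false (subst (λ i → U i ≡ true) u₀≡a Uu₀) Ua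

        T₁ = T [ u₀ ]≔ false

      T′ : Sub (suc n)
      T′ = T₁ [ a ]≔ true

      private
        T′a : T′ a ≡ true
        T′a = []≔-at T₁ a true

        T′u₀ : T′ u₀ ≡ false
        T′u₀ = trans ([]≔-other T₁ a true u₀ u₀≢a) ([]≔-at T u₀ false)

        T′-≢a : ∀ i → i ≢ a → T′ i ≡ true → T i ≡ true
        T′-≢a i i≢a T′i = []≔-false-⊆ T u₀ i (trans (sym ([]≔-other T₁ a true i i≢a)) T′i)

        T′-cases : ∀ i → T′ i ≡ true → i ≡ a ⊎ T i ≡ true
        T′-cases i T′i = pick (i ≟ a)
          where
          pick : Dec (i ≡ a) → i ≡ a ⊎ T i ≡ true
          pick (yes i≡a) = inj₁ i≡a
          pick (no  i≢a) = inj₂ (T′-≢a i i≢a T′i)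

      T′⊆S : T′ ⊆ S
      T′⊆S i T′i with T′-cases i T′i
      ... | inj₁ refl = Sa
      ... | inj₂ Ti   = T⊆S i Ti

      card-T′ : card T′ ≡ card T
      card-T′ = +-cancelʳ-≡ 0 (card T′) (card T)
        (begin
          card T′ + 0           ≡⟨ cong (λ b → card T′ + bit b) (sym T₁a) ⟩
          card T′ + bit (T₁ a)  ≡⟨ card-[]≔ T₁ a true ⟩
          card T₁ + 1           ≡⟨ cong (λ b → card T₁ + bit b) (sym (U⊆T u₀ Uu₀)) ⟩
          card T₁ + bit (T u₀)  ≡⟨ card-[]≔ T u₀ false ⟩
          card T + 0            ∎)
        where
        open ≡-Reasoning
        T₁a : T₁ a ≡ false
        T₁a = trans ([]≔-other T u₀ false a (λ a≡u₀ → u₀≢a (sym a≡u₀))) Ta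

      -- If W ⊆ T′ contains a, then W + F lies in T and still contains u₀, and it has the row sums of W
      -- because F sums to zero.
      private
        corrected-⊆ : ∀ W → W ⊆ T′ → W a ≡ true → (λ i → W i xor F i) ⊆ T
        corrected-⊆ W W⊆T′ Wa i i∈ = pick (i ≟ a) (U i) refl
          where
          pick : Dec (i ≡ a) → ∀ b → U i ≡ b → T i ≡ true
          pick (yes refl) _     _  = ⊥-elim (≡true⇒≢false i∈ (cong₂ _xor_ Wa Fa))
          pick (no  i≢a)  true  Ui = U⊆T i Ui
          pick (no  i≢a)  false Ui = T′-≢a i i≢a (W⊆T′ i Wi)
            where
            Wi : W i ≡ true
            Wi = trans (sym (xor-identityʳ (W i)))
                   (trans (cong (W i xor_) (sym (trans (rowOp-family-≢ y a U i i≢a) Ui))) i∈)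

        corrected-nonempty : ∀ W → W ⊆ T′ → Nonempty (λ i → W i xor F i)
        corrected-nonempty W W⊆T′ =
          u₀ , trans (cong₂ _xor_ (⊆⇒∉ W⊆T′ u₀ T′u₀) (rowOp-family-≢ y a U u₀ u₀≢a)) Uu₀

        independent-through : ∀ W → W ⊆ T′ → Nonempty W → ∃ λ v → rowSum G S W v ≡ true
        independent-through W W⊆T′ W≢∅ with W a in Wa
        ... | false = ind W W⊆T W≢∅
          where
          W⊆T : W ⊆ T
          W⊆T i Wi with T′-cases i (W⊆T′ i Wi)
          ... | inj₁ refl = ⊥-elim (≡true⇒≢false Wi Wa)
          ... | inj₂ Ti   = Ti
        ... | true =
          let v , v∈ = ind _ (corrected-⊆ W W⊆T′ Wa) (corrected-nonempty W W⊆T′)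
          in v , trans (sym (trans (rowSum-xor G S W F v)
                                (trans (cong (rowSum G S W v xor_) (F-dependent v)) (xor-identityʳ _)))) v∈

      T′-independent : Independent G′ S T′
      T′-independent V V⊆T′ V≢∅ =
        let v , v∈ = independent-through (rowOp-family y a V) (rowOp-family-⊆ y a V⊆T′ T′a)
                                         (rowOp-family-nonempty y a ya V V≢∅)
        in v , trans (rowSum-rowOp G S a y V v) v∈

    card≤rank-rowOp : ∀ T → T ⊆ S → Independent G S T → card T ≤ rank G′ S
    card≤rank-rowOp T T⊆S ind with T a in Ta | independentᵇ G′ S T in ind′
    ... | true  | _     = card≤rank G′ S T T⊆S (independent-rowOp-∋ T Ta ind)
    ... | false | true  = card≤rank G′ S T T⊆S (independentᵇ-sound G′ S T ind′)
    ... | false | false =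
      let U , U⊆T , U≢∅ , dependent = independentᵇ-false G′ S T ind′
          open Exchange T T⊆S ind Ta U U⊆T U≢∅ dependent
      in ≤-trans (≤-reflexive (sym card-T′)) (card≤rank G′ S T′ T′⊆S T′-independent)

    rank≤rank-rowOp : rank G S ≤ rank G′ S
    rank≤rank-rowOp =
      let T , T⊆S , ind , cardT = rank-attained G S
      in ≤-trans (≤-reflexive (sym cardT)) (card≤rank-rowOp T T⊆S ind)

  rank-rowOp : ∀ {n} (G : Graph (suc n)) S a y → S a ≡ true → y a ≡ false → rank (rowOp G a y) S ≡ rank G S
  rank-rowOp G S a y Sa ya = ≤-antisym
    (≤-trans (rank≤rank-rowOp (rowOp G a y) S a y Sa ya)
             (≤-reflexive (rank-cong-graph _ G S (λ u v _ _ → rowOp-involutive G a y ya u v))))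
    (rank≤rank-rowOp G S a y Sa ya)

  -- Eliminating a looped vertex

  schur : ∀ {n} → Fin n → Graph n → Graph n
  schur a G u w = G u w xor (G u a ∧ G a w)

  rank-eliminate : ∀ {n} (G : Graph (suc n)) S a → S a ≡ false → G a a ≡ true →
    rank G (S [ a ]≔ true) ≡ suc (rank (schur a G) S)
  rank-eliminate G S a Sa Gaa =
    begin
      rank G Sᵃ                         ≡⟨ sym (rank-rowOp G Sᵃ a y Sᵃa ya) ⟩
      rank G₁ Sᵃ                        ≡⟨ sym (rank-colOp G₁ Sᵃ a z Sᵃa za) ⟩
      rank G₂ Sᵃ                        ≡⟨ rank-isolated G₂ S a Sa column row ⟩
      bit (G₂ a a) + rank G₂ S          ≡⟨ cong₂ (λ b r → bit b + r) G₂aa (rank-cong-graph G₂ (schur a G) S inner) ⟩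
      suc (rank (schur a G) S)          ∎
    where
    open ≡-Reasoning
    Sᵃ = S [ a ]≔ true
    Sᵃa = []≔-at S a true
    y z : Sub _
    y u = not (u == a) ∧ G u a
    z w = not (w == a) ∧ G a w
    ya : y a ≡ false
    ya rewrite ==-refl a = refl
    za : z a ≡ false
    za rewrite ==-refl a = refl
    G₁ = rowOp G a y
    G₂ = colOp G₁ a z
    ∈S⇒≢a : ∀ {u} → S u ≡ true → u ≢ a
    ∈S⇒≢a Su refl = ≡true⇒≢false Su Sa
    G₁-row-a : ∀ v → G₁ a v ≡ G a v
    G₁-row-a v rewrite ya = xor-identityʳ (G a v)
    G₁-column-a : ∀ u → u ≢ a → G₁ u a ≡ false
    G₁-column-a u u≢a rewrite ==-≢ u≢a | Gaa | ∧-identityʳ (G u a) = xor-same (G u a)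
    G₂-column-a : ∀ u → G₂ u a ≡ G₁ u a
    G₂-column-a u rewrite za = xor-identityʳ (G₁ u a)
    G₂aa : G₂ a a ≡ true
    G₂aa = trans (G₂-column-a a) (trans (G₁-row-a a) Gaa)
    column : ∀ u → S u ≡ true → G₂ u a ≡ false
    column u Su = trans (G₂-column-a u) (G₁-column-a u (∈S⇒≢a Su))
    row : ∀ v → S v ≡ true → G₂ a v ≡ false
    row v Sv rewrite G₁-row-a v | G₁-row-a a | Gaa | ==-≢ (∈S⇒≢a Sv) | ∧-identityʳ (G a v) = xor-same (G a v)
    inner : ∀ u v → S u ≡ true → S v ≡ true → G₂ u v ≡ schur a G u v
    inner u v Su Sv rewrite G₁-column-a u (∈S⇒≢a Su) | ∧-zeroʳ (z v) | ==-≢ (∈S⇒≢a Su) =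
      xor-identityʳ (G u v xor (G u a ∧ G a v))

  -- Pivoting on an edge ab

  pivot-entry : ∀ p q r s → ((p ∧ q ∧ (not r ∨ not s)) ∨ (s ∧ r ∧ (not q ∨ not p))) ≡ (p ∧ q) xor (r ∧ s)
  pivot-entry true  true  true  true  = refl
  pivot-entry true  true  true  false = refl
  pivot-entry true  true  false true  = refl
  pivot-entry true  true  false false = refl
  pivot-entry true  false true  true  = refl
  pivot-entry true  false true  false = refl
  pivot-entry true  false false true  = refl
  pivot-entry true  false false false = refl
  pivot-entry false true  true  true  = refl
  pivot-entry false true  true  false = refl
  pivot-entry false true  false true  = refl
  pivot-entry false true  false false = refl
  pivot-entry false false true  true  = refl
  pivot-entry false false true  false = refl
  pivot-entry false false false true  = refl
  pivot-entry false false false false = refl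

  pivot-outside : ∀ {n} (G : Graph n) a b u w → SymmetricGraph G →
    u ≢ a → u ≢ b → w ≢ a → w ≢ b →
    pivot a b G u w ≡ G u w xor ((G u a ∧ G b w) xor (G u b ∧ G a w))
  pivot-outside G a b u w sym u≢a u≢b w≢a w≢b
    rewrite ==-≢ u≢a | ==-≢ u≢b | ==-≢ w≢a | ==-≢ w≢b | sym w b | sym w a =
    cong (G u w xor_) (pivot-entry (G u a) (G b w) (G u b) (G a w))

  pivot-row-a : ∀ {n} (G : Graph n) a b w → pivot a b G a w ≡ G a w
  pivot-row-a G a b w rewrite ==-refl a | ∧-zeroʳ (not (w == a) ∧ not (w == b)) = xor-identityʳ (G a w)

  pivot-column-a : ∀ {n} (G : Graph n) a b u → pivot a b G u a ≡ G u a
  pivot-column-a G a b u rewrite ==-refl a | ∧-zeroʳ (not (u == a) ∧ not (u == b)) = xor-identityʳ (G u a)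

  module _ {n} (G : Graph (suc n)) (symmetric : SymmetricGraph G) {a b : Fin (suc n)} (a≢b : a ≢ b)
           (Gaa : G a a ≡ false) where

    rank-pivot-one : ∀ S → S a ≡ true → S b ≡ false → rank (pivot a b G) S ≡ rank G S
    rank-pivot-one S Sa Sb =
      begin
        rank (pivot a b G) S  ≡⟨ sym (rank-cong-graph G₂ (pivot a b G) S agree) ⟩
        rank G₂ S             ≡⟨ rank-colOp G₁ S a z Sa za ⟩
        rank G₁ S             ≡⟨ rank-rowOp G S a y Sa ya ⟩
        rank G S              ∎
      where
      open ≡-Reasoning
      y z : Sub _
      y u = not (u == a) ∧ G u b
      z w = not (w == a) ∧ G b w
      ya : y a ≡ false
      ya rewrite ==-refl a = refl
      za : z a ≡ false
      za rewrite ==-refl a = refl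
      G₁ = rowOp G a y
      G₂ = colOp G₁ a z
      ∈S⇒≢b : ∀ {u} → S u ≡ true → u ≢ b
      ∈S⇒≢b Su refl = ≡true⇒≢false Su Sb
      G₁-column-a : ∀ u → G₁ u a ≡ G u a
      G₁-column-a u rewrite Gaa | ∧-zeroʳ (y u) = xor-identityʳ (G u a)
      G₂-row-a : ∀ v → G₂ a v ≡ G a v
      G₂-row-a v rewrite G₁-column-a a | Gaa | ∧-zeroʳ (z v) | ya =
        trans (xor-identityʳ (G a v xor false)) (xor-identityʳ (G a v))
      G₂-column-a : ∀ u → G₂ u a ≡ G u a
      G₂-column-a u rewrite za = trans (xor-identityʳ (G₁ u a)) (G₁-column-a u)
      G₂-outside : ∀ u v → u ≢ a → v ≢ a → G₂ u v ≡ G u v xor ((G u a ∧ G b v) xor (G u b ∧ G a v))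
      G₂-outside u v u≢a v≢a rewrite G₁-column-a u | ==-≢ u≢a | ==-≢ v≢a = regroup (G u v) (G u b) (G a v) (G b v) (G u a)
        where
        open xor-∧-Solver
        regroup : ∀ g r s t p → ((g xor (r ∧ s)) xor (t ∧ p)) ≡ g xor ((p ∧ t) xor (r ∧ s))
        regroup = solve 5 (λ g r s t p → (g :+ r :* s) :+ t :* p := g :+ (p :* t :+ r :* s)) refl
      agree : ∀ u v → S u ≡ true → S v ≡ true → G₂ u v ≡ pivot a b G u v
      agree u v Su Sv = pick (u ≟ a) (v ≟ a)
        where
        pick : Dec (u ≡ a) → Dec (v ≡ a) → G₂ u v ≡ pivot a b G u v
        pick (yes refl) _          = trans (G₂-row-a v) (sym (pivot-row-a G a b v))
        pick (no u≢a)   (yes refl) = trans (G₂-column-a u) (sym (pivot-column-a G a b u))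
        pick (no u≢a)   (no v≢a)   = trans (G₂-outside u v u≢a v≢a)
          (sym (pivot-outside G a b u v symmetric u≢a (∈S⇒≢b Su) v≢a (∈S⇒≢b Sv)))

    rank-pivot-two : ∀ S → S a ≡ false → S b ≡ false → G b b ≡ false → G a b ≡ true →
      rank G ((S [ b ]≔ true) [ a ]≔ true) ≡ suc (suc (rank (pivot a b G) S))
    rank-pivot-two S Sa Sb Gbb Gab =
      begin
        rank G S″                         ≡⟨ sym (rank-colOp G S″ b e S″b eb) ⟩
        rank G₁ S″                        ≡⟨ rank-eliminate G₁ S′ a S′a G₁aa ⟩
        suc (rank H S′)                   ≡⟨ cong suc (rank-eliminate H S b Sb Hbb) ⟩
        suc (suc (rank (schur b H) S))    ≡⟨ cong (λ r → suc (suc r)) (rank-cong-graph (schur b H) (pivot a b G) S agree) ⟩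
        suc (suc (rank (pivot a b G) S))  ∎
      where
      open ≡-Reasoning
      b≢a : b ≢ a
      b≢a b≡a = a≢b (sym b≡a)
      cancel : ∀ x r → x xor (r xor r) ≡ x
      cancel x r = trans (cong (x xor_) (xor-same r)) (xor-identityʳ x)
      S′ = S [ b ]≔ true
      S″ = S′ [ a ]≔ true
      e : Sub _
      e i = i == a
      eb : e b ≡ false
      eb = ==-≢ b≢a
      S″b : S″ b ≡ true
      S″b = trans ([]≔-other S′ a true b b≢a) ([]≔-at S b true)
      S′a : S′ a ≡ false
      S′a = trans ([]≔-other S b true a a≢b) Sa
      G₁ = colOp G b e
      H = schur a G₁
      Gba : G b a ≡ true
      Gba = trans (symmetric b a) Gab
      G₁aa : G₁ a a ≡ true
      G₁aa rewrite ==-refl a | Gaa | Gab = refl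
      Hbb : H b b ≡ true
      Hbb rewrite eb | ==-refl a | Gbb | Gba | Gab = refl
      agree : ∀ u v → S u ≡ true → S v ≡ true → schur b H u v ≡ pivot a b G u v
      agree u v Su Sv =
        begin
          H u v xor (H u b ∧ H b v)
        ≡⟨ cong₂ (λ h k → h xor k) H-uv (cong₂ _∧_ H-ub H-bv) ⟩
          (G u v xor ((G u a xor G u b) ∧ G a v)) xor (G u a ∧ (G b v xor G a v))
        ≡⟨ char2 (G u v) (G u a) (G u b) (G a v) (G b v) ⟩
          G u v xor ((G u a ∧ G b v) xor (G u b ∧ G a v))
        ≡⟨ sym (pivot-outside G a b u v symmetric u≢a u≢b v≢a v≢b) ⟩
          pivot a b G u v
        ∎
        where
        open xor-∧-Solver
        u≢a : u ≢ a
        u≢a refl = ≡true⇒≢false Su Sa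
        u≢b : u ≢ b
        u≢b refl = ≡true⇒≢false Su Sb
        v≢a : v ≢ a
        v≢a refl = ≡true⇒≢false Sv Sa
        v≢b : v ≢ b
        v≢b refl = ≡true⇒≢false Sv Sb
        H-ub : H u b ≡ G u a
        H-ub rewrite eb | ==-refl a | Gab =
          trans (solve 2 (λ p r → (r :+ con false) :+ ((p :+ r) :* con true) := p :+ (r :+ r)) refl (G u a) (G u b))
                (cancel (G u a) (G u b))
        H-bv : H b v ≡ G b v xor G a v
        H-bv rewrite ==-≢ v≢a | ==-refl a | Gbb | Gba =
          solve 2 (λ t s → (t :+ con false) :+ (s :+ con false) := t :+ s) refl (G b v) (G a v)
        H-uv : H u v ≡ G u v xor ((G u a xor G u b) ∧ G a v)
        H-uv rewrite ==-≢ v≢a | ==-refl a =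
          solve 4 (λ g p r s → (g :+ con false) :+ ((p :+ r) :* (s :+ con false)) := g :+ (p :+ r) :* s) refl
            (G u v) (G u a) (G u b) (G a v)
        char2 : ∀ g p r s t → (g xor ((p xor r) ∧ s)) xor (p ∧ (t xor s)) ≡ g xor ((p ∧ t) xor (r ∧ s))
        char2 g p r s t =
          trans (solve 5 (λ g p r s t → (g :+ (p :+ r) :* s) :+ p :* (t :+ s)
                                      := (g :+ (p :* t :+ r :* s)) :+ (p :* s :+ p :* s)) refl g p r s t)
                (cancel (g xor ((p ∧ t) xor (r ∧ s))) (p ∧ s))

  schur≡localComp : ∀ {n} (G : Graph n) a u v → SymmetricGraph G → u ≢ a → v ≢ a →
    schur a G u v ≡ localComp a G u v
  schur≡localComp G a u v sym u≢a v≢a rewrite ==-≢ u≢a | ==-≢ v≢a | sym u a = refl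

  rank-insert-looped : ∀ {n} (G : Graph (suc n)) a s → SymmetricGraph G → G a a ≡ true →
    rank G (insert a true s) ≡ suc (rank (delete a (localComp a G)) s)
  rank-insert-looped G a s sym Gaa =
    begin
      rank G (insert a true s)                      ≡⟨ rank-cong-sub G (insert≗[]≔ a true s) ⟩
      rank G (S [ a ]≔ true)                        ≡⟨ rank-eliminate G S a (insert-at a false s) Gaa ⟩
      suc (rank (schur a G) S)                      ≡⟨ cong suc (rank-cong-graph _ _ S schur≡) ⟩
      suc (rank (localComp a G) S)                  ≡⟨ cong suc (rank-delete (localComp a G) a s) ⟩
      suc (rank (delete a (localComp a G)) s)       ∎
    where
    open ≡-Reasoning
    S = insert a false s
    schur≡ : ∀ u v → S u ≡ true → S v ≡ true → schur a G u v ≡ localComp a G u v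
    schur≡ u v Su Sv = schur≡localComp G a u v sym (insert-false-∌ a s u Su) (insert-false-∌ a s v Sv)

  rank-insert-isolated : ∀ {n} (G : Graph (suc n)) a s →
    (∀ u → u ≢ a → G u a ≡ false) → (∀ v → v ≢ a → G a v ≡ false) →
    rank G (insert a true s) ≡ bit (G a a) + rank (delete a G) s
  rank-insert-isolated G a s column row =
    begin
      rank G (insert a true s)            ≡⟨ rank-cong-sub G (insert≗[]≔ a true s) ⟩
      rank G (S [ a ]≔ true)              ≡⟨ rank-isolated G S a (insert-at a false s)
                                               (λ u Su → column u (insert-false-∌ a s u Su))
                                               (λ v Sv → row v (insert-false-∌ a s v Sv)) ⟩
      bit (G a a) + rank G S              ≡⟨ cong (bit (G a a) +_) (rank-delete G a s) ⟩
      bit (G a a) + rank (delete a G) s   ∎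
    where
    open ≡-Reasoning
    S = insert a false s

  punchIn-punchIn-comm : ∀ {n} (a b : Fin (suc (suc n))) (a≢b : a ≢ b) (b≢a : b ≢ a) (i : Fin n) →
    punchIn b (punchIn (punchOut b≢a) i) ≡ punchIn a (punchIn (punchOut a≢b) i)
  punchIn-punchIn-comm zero    zero    a≢b b≢a i = ⊥-elim (a≢b refl)
  punchIn-punchIn-comm zero    (suc b) a≢b b≢a i = refl
  punchIn-punchIn-comm (suc a) zero    a≢b b≢a i = refl
  punchIn-punchIn-comm {suc n} (suc a) (suc b) a≢b b≢a zero    = refl
  punchIn-punchIn-comm {suc n} (suc a) (suc b) a≢b b≢a (suc i) =
    cong suc (punchIn-punchIn-comm a b (a≢b ∘ cong suc) (b≢a ∘ cong suc) i)

  insert-insert-comm : ∀ {n} (a b : Fin (suc (suc n))) (a≢b : a ≢ b) (b≢a : b ≢ a) c (t : Sub n) →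
    insert b false (insert (punchOut b≢a) c t) ≗ insert a c (insert (punchOut a≢b) false t)
  insert-insert-comm a b a≢b b≢a c t = ≗-by-punchIn a at-a (≗-by-punchIn b′ at-b elsewhere)
    where
    a′ = punchOut b≢a
    b′ = punchOut a≢b
    L = insert b false (insert a′ c t)
    at-a : L a ≡ insert a c (insert b′ false t) a
    at-a = trans (cong L (sym (punchIn-punchOut b≢a)))
             (trans (insert-punchIn b false _ a′) (trans (insert-at a′ c t) (sym (insert-at a c _))))
    at-b : L (punchIn a b′) ≡ insert a c (insert b′ false t) (punchIn a b′)
    at-b = trans (cong L (punchIn-punchOut a≢b))
             (trans (insert-at b false _) (sym (trans (insert-punchIn a c _ b′) (insert-at b′ false t))))
    elsewhere : ∀ j → L (punchIn a (punchIn b′ j)) ≡ insert a c (insert b′ false t) (punchIn a (punchIn b′ j))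
    elsewhere j = trans (cong L (sym (punchIn-punchIn-comm a b a≢b b≢a j)))
      (trans (insert-punchIn b false _ (punchIn a′ j)) (trans (insert-punchIn a′ c t j)
        (sym (trans (insert-punchIn a c _ (punchIn b′ j)) (insert-punchIn b′ false t j)))))

  insert-insert≗[]≔ : ∀ {n} (a : Fin (suc (suc n))) b′ c d (t : Sub n) →
    insert a c (insert b′ d t) ≗ ((insert a false (insert b′ false t) [ punchIn a b′ ]≔ d) [ a ]≔ c)
  insert-insert≗[]≔ a b′ c d t = ≗-by-punchIn a
    (trans (insert-at a c _) (sym ([]≔-at S′ a c)))
    (λ i → trans (insert-punchIn a c _ i)
      (sym (trans ([]≔-other S′ a c (punchIn a i) (punchInᵢ≢i a i)) (inner i))))
    where
    S = insert a false (insert b′ false t)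
    S′ = S [ punchIn a b′ ]≔ d
    inner : ∀ i → (S [ punchIn a b′ ]≔ d) (punchIn a i) ≡ insert b′ d t i
    inner = ≗-by-punchIn b′
      (trans ([]≔-at S (punchIn a b′) d) (sym (insert-at b′ d t)))
      (λ j → trans ([]≔-other S (punchIn a b′) d _ (punchInᵢ≢i b′ j ∘ punchIn-injective a _ _))
        (trans (insert-punchIn a false _ (punchIn b′ j))
          (trans (insert-punchIn b′ false t j) (sym (insert-punchIn b′ d t j)))))

  module _ {n} (G : Graph (suc (suc n))) (symmetric : SymmetricGraph G) {a b : Fin (suc (suc n))} (a≢b : a ≢ b)
           (Gaa : G a a ≡ false) (t : Sub n) where

    private
      b′ = punchOut a≢b

      insert-at-b : ∀ c d → insert a c (insert b′ d t) b ≡ d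
      insert-at-b c d = trans (cong (insert a c (insert b′ d t)) (sym (punchIn-punchOut a≢b)))
                              (trans (insert-punchIn a c _ b′) (insert-at b′ d t))

    rank-insert-pivot-one : rank (pivot a b G) (insert a true (insert b′ false t)) ≡ rank G (insert a true (insert b′ false t))
    rank-insert-pivot-one =
      rank-pivot-one G symmetric a≢b Gaa (insert a true (insert b′ false t)) (insert-at a true _) (insert-at-b true false)

    rank-insert-pivot-two : G b b ≡ false → G a b ≡ true →
      rank G (insert a true (insert b′ true t)) ≡ suc (suc (rank (pivot a b G) (insert a false (insert b′ false t))))
    rank-insert-pivot-two Gbb Gab =
      trans (rank-cong-sub G (λ v → trans (insert-insert≗[]≔ a b′ true true t v)
                                          (cong (λ w → ((S [ w ]≔ true) [ a ]≔ true) v) (punchIn-punchOut a≢b))))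
            (rank-pivot-two G symmetric a≢b Gaa S (insert-at a false _) (insert-at-b false false) Gbb Gab)
      where
      S = insert a false (insert b′ false t)

open Rank

module Polynomial {c ℓ} (R : CommutativeRing c ℓ) (x y : CommutativeRing.Carrier R) where

  open import Data.Nat using (zero; _≤_; _∸_)
  open import Data.Nat.Properties using (+-∸-assoc)
  open import Data.Bool using (Bool)
  open import Data.Fin using (zero; suc)
  open import Data.Fin.Properties using (punchIn-punchOut; suc-injective)
  open import Data.List using (List; []; _∷_; concatMap)
  open import Function using (_∘_)
  import Relation.Binary.PropositionalEquality as ≡
  open ≡ using (_≗_)

  open CommutativeRing R hiding (zero)
  open import Relation.Binary.Reasoning.Setoid setoid
  open import Algebra.Solver.Ring.NaturalCoefficients.Default commutativeSemiring

  X Y : Carrier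
  X = x - 1#
  Y = y - 1#

  weight : ∀ {n} → (Fin n → Carrier) → (Fin n → Carrier) → Sub n → Carrier
  weight α β S = prodFin R (λ v → if S v then α v else β v)

  -- The summand of a subset with m elements whose induced subgraph has rank r, hence nullity m ∸ r.
  monomial : ℕ → ℕ → Carrier
  monomial r m = pow R X r * pow R Y (m ∸ r)

  monomial-suc-rank : ∀ r m → monomial (suc r) (suc m) ≈ X * monomial r m
  monomial-suc-rank r m = *-assoc X _ _

  monomial-suc-card : ∀ {r m} → r ≤ m → monomial r (suc m) ≈ Y * monomial r m
  monomial-suc-card {r} {m} r≤m =
    trans (*-congˡ (reflexive (≡.cong (pow R Y) (+-∸-assoc 1 r≤m))))
          (solve 3 (λ p Y q → p :* (Y :* q) := Y :* (p :* q)) refl _ Y _)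

  sumList-cong : ∀ {n} (L : List (Sub n)) {f g : Sub n → Carrier} → (∀ S → f S ≈ g S) →
    sumList R L f ≈ sumList R L g
  sumList-cong []      f≈g = refl
  sumList-cong (S ∷ L) f≈g = +-cong (f≈g S) (sumList-cong L f≈g)

  sumList-*ˡ : ∀ {n} (L : List (Sub n)) k (f : Sub n → Carrier) →
    sumList R L (λ S → k * f S) ≈ k * sumList R L f
  sumList-*ˡ []      k f = sym (zeroʳ k)
  sumList-*ˡ (S ∷ L) k f = trans (+-congˡ (sumList-*ˡ L k f)) (sym (distribˡ k (f S) _))

  sumList-concatMap : ∀ {n} (L : List (Sub n)) (F : Sub (suc n) → Carrier) →
    sumList R (concatMap (λ s → cons false s ∷ cons true s ∷ []) L) F ≈
    sumList R L (F ∘ cons false) + sumList R L (F ∘ cons true)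
  sumList-concatMap []      F = sym (+-identityˡ 0#)
  sumList-concatMap (s ∷ L) F =
    trans (+-congˡ (+-congˡ (sumList-concatMap L F)))
          (solve 4 (λ a b A B → a :+ (b :+ (A :+ B)) := (a :+ A) :+ (b :+ B)) refl _ _ _ _)

  Σ-subsets : ∀ n → (Sub n → Carrier) → Carrier
  Σ-subsets n = sumList R (subsets n)

  Σ-cong : ∀ {n} {f g : Sub n → Carrier} → (∀ S → f S ≈ g S) → Σ-subsets n f ≈ Σ-subsets n g
  Σ-cong {n} = sumList-cong (subsets n)

  Σ-factor : ∀ {n} k {f g : Sub n → Carrier} → (∀ S → f S ≈ k * g S) → Σ-subsets n f ≈ k * Σ-subsets n g
  Σ-factor {n} k {g = g} f≈kg = trans (Σ-cong f≈kg) (sumList-*ˡ (subsets n) k g)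

  Σ-split : ∀ {n} (a : Fin (suc n)) (F : Sub (suc n) → Carrier) →
    Σ-subsets (suc n) F ≈ Σ-subsets n (F ∘ insert a false) + Σ-subsets n (F ∘ insert a true)
  Σ-split {n}     zero    F = sumList-concatMap (subsets n) F
  Σ-split {suc n} (suc a) F =
    begin
      Σ-subsets (suc (suc n)) F
    ≈⟨ sumList-concatMap (subsets (suc n)) F ⟩
      Σ-subsets (suc n) (F ∘ cons false) + Σ-subsets (suc n) (F ∘ cons true)
    ≈⟨ +-cong (Σ-split a (F ∘ cons false)) (Σ-split a (F ∘ cons true)) ⟩
      (Σ-subsets n (F ∘ cons false ∘ insert a false) + Σ-subsets n (F ∘ cons false ∘ insert a true)) +
      (Σ-subsets n (F ∘ cons true ∘ insert a false) + Σ-subsets n (F ∘ cons true ∘ insert a true))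
    ≈⟨ solve 4 (λ A B C D → (A :+ B) :+ (C :+ D) := (A :+ C) :+ (B :+ D)) refl _ _ _ _ ⟩
      (Σ-subsets n (F ∘ cons false ∘ insert a false) + Σ-subsets n (F ∘ cons true ∘ insert a false)) +
      (Σ-subsets n (F ∘ cons false ∘ insert a true) + Σ-subsets n (F ∘ cons true ∘ insert a true))
    ≈⟨ sym (+-cong (sumList-concatMap (subsets n) (F ∘ insert (suc a) false))
                   (sumList-concatMap (subsets n) (F ∘ insert (suc a) true))) ⟩
      Σ-subsets (suc n) (F ∘ insert (suc a) false) + Σ-subsets (suc n) (F ∘ insert (suc a) true)
    ∎

  prodFin-cong : ∀ {n} {f g : Fin n → Carrier} → (∀ i → f i ≈ g i) → prodFin R f ≈ prodFin R g
  prodFin-cong {zero}  f≈g = refl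
  prodFin-cong {suc n} f≈g = *-cong (f≈g zero) (prodFin-cong (f≈g ∘ suc))

  prodFin-punchIn : ∀ {n} (a : Fin (suc n)) (f : Fin (suc n) → Carrier) →
    prodFin R f ≈ f a * prodFin R (f ∘ punchIn a)
  prodFin-punchIn zero    f = refl
  prodFin-punchIn {suc n} (suc a) f =
    trans (*-congˡ (prodFin-punchIn a (f ∘ suc)))
          (solve 3 (λ p q r → p :* (q :* r) := q :* (p :* r)) refl _ _ _)

  weight-insert : ∀ {n} (a : Fin (suc n)) b (s : Sub n) (α β : Fin (suc n) → Carrier) →
    weight α β (insert a b s) ≈ (if b then α a else β a) * weight (α ∘ punchIn a) (β ∘ punchIn a) s
  weight-insert a b s α β = trans (prodFin-punchIn a (λ v → if insert a b s v then α v else β v))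
    (*-cong (reflexive (≡.cong (λ e → if e then α a else β a) (insert-at a b s)))
            (prodFin-cong (λ i → reflexive (≡.cong (λ e → if e then α (punchIn a i) else β (punchIn a i))
                                                   (insert-punchIn a b s i)))))

  Σ-weighted : ∀ {n} → (Fin n → Carrier) → (Fin n → Carrier) → (Sub n → Carrier) → Carrier
  Σ-weighted {n} α β f = Σ-subsets n (λ S → weight α β S * f S)

  Σ-weighted-cong : ∀ {n} (α β : Fin n → Carrier) {f g} → (∀ S → f S ≈ g S) →
    Σ-weighted α β f ≈ Σ-weighted α β g
  Σ-weighted-cong α β f≈g = Σ-cong (λ S → *-congˡ (f≈g S))

  Σ-weighted-factor : ∀ {n} (α β : Fin n → Carrier) k {f g} → (∀ S → f S ≈ k * g S) →
    Σ-weighted α β f ≈ k * Σ-weighted α β g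
  Σ-weighted-factor α β k f≈kg =
    Σ-factor k (λ S → trans (*-congˡ (f≈kg S)) (solve 3 (λ w k g → w :* (k :* g) := k :* (w :* g)) refl _ k _))

  monomialOf : ∀ {n} → Graph n → Sub n → Carrier
  monomialOf G S = monomial (rank G S) (card S)

  q-as-sum : ∀ {n} (α β : Fin n → Carrier) (G : Graph n) → q R x y α β G ≈ Σ-weighted α β (monomialOf G)
  q-as-sum {n} α β G = Σ-cong {n} (λ S → *-assoc _ _ _)

  monomialOf-delete : ∀ {n} (G : Graph (suc n)) a s → monomialOf (delete a G) s ≡ monomialOf G (insert a false s)
  monomialOf-delete G a s = ≡.sym (≡.cong₂ monomial (rank-delete G a s) (card-insert a false s))

  monomialOf-cong : ∀ {n} (G : Graph n) {S S′} → S ≗ S′ → monomialOf G S ≡ monomialOf G S′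
  monomialOf-cong G S≗S′ = ≡.cong₂ monomial (rank-cong-sub G S≗S′) (card-cong S≗S′)

  q-split : ∀ {n} (a : Fin (suc n)) (α β : Fin (suc n) → Carrier) (G : Graph (suc n)) →
    q R x y α β G ≈
      β a * Σ-weighted (α ∘ punchIn a) (β ∘ punchIn a) (monomialOf G ∘ insert a false)
      + α a * Σ-weighted (α ∘ punchIn a) (β ∘ punchIn a) (monomialOf G ∘ insert a true)
  q-split a α β G = trans (q-as-sum α β G) (trans (Σ-split a _)
    (+-cong (Σ-factor (β a) (λ s → trans (*-congʳ (weight-insert a false s α β)) (*-assoc _ _ _)))
            (Σ-factor (α a) (λ s → trans (*-congʳ (weight-insert a true s α β)) (*-assoc _ _ _)))))

  q-expand : ∀ {n} (a : Fin (suc n)) (α β : Fin (suc n) → Carrier) (G : Graph (suc n)) →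
    q R x y α β G ≈
      β a * q R x y (α ∘ punchIn a) (β ∘ punchIn a) (delete a G)
      + α a * Σ-weighted (α ∘ punchIn a) (β ∘ punchIn a) (monomialOf G ∘ insert a true)
  q-expand a α β G = trans (q-split a α β G) (+-congʳ (*-congˡ
    (trans (Σ-weighted-cong _ _ (λ s → reflexive (≡.sym (monomialOf-delete G a s))))
           (sym (q-as-sum _ _ (delete a G))))))

  q-looped : ∀ {n} (G : Graph (suc n)) (α β : Fin (suc n) → Carrier) → SymmetricGraph G →
    (a : Fin (suc n)) → G a a ≡ true →
    q R x y α β G
      ≈ β a * q R x y (α ∘ punchIn a) (β ∘ punchIn a) (delete a G)
        + α a * X * q R x y (α ∘ punchIn a) (β ∘ punchIn a) (delete a (localComp a G))
  q-looped G α β symmetric a Gaa =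
    trans (q-expand a α β G) (+-congˡ (trans (*-congˡ containing-a) (sym (*-assoc _ _ _))))
    where
    G′ = delete a (localComp a G)
    containing-a : Σ-weighted (α ∘ punchIn a) (β ∘ punchIn a) (monomialOf G ∘ insert a true)
                   ≈ X * q R x y (α ∘ punchIn a) (β ∘ punchIn a) G′
    containing-a =
      trans (Σ-weighted-factor _ _ X (λ s →
               trans (reflexive (≡.cong₂ monomial (rank-insert-looped G a s symmetric Gaa) (card-insert a true s)))
                     (monomial-suc-rank (rank G′ s) (card s))))
            (*-congˡ (sym (q-as-sum (α ∘ punchIn a) (β ∘ punchIn a) G′)))

  q-edgeless : ∀ {n} (G : Graph n) (α β : Fin n → Carrier) → (∀ u v → u ≢ v → G u v ≡ false) →
    q R x y α β G
      ≈ prodFin R (λ v → if G v v then 1# else α v * Y + β v)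
        * prodFin R (λ v → if G v v then α v * X + β v else 1#)
  q-edgeless {zero}  G α β edgeless = trans (+-identityʳ _) (*-identityʳ _)
  q-edgeless {suc n} G α β edgeless =
    begin
      q R x y α β G
    ≈⟨ q-expand zero α β G ⟩
      β zero * Q + α zero * Σ-weighted (α ∘ suc) (β ∘ suc) (monomialOf G ∘ insert zero true)
    ≈⟨ +-congˡ (*-congˡ (trans (Σ-weighted-factor _ _ (factor (G zero zero)) vertex-factor)
                               (*-congˡ (sym (q-as-sum _ _ G′))))) ⟩
      β zero * Q + α zero * (factor (G zero zero) * Q)
    ≈⟨ +-cong (*-congˡ IH) (*-congˡ (*-congˡ IH)) ⟩
      β zero * (P₁ * P₂) + α zero * (factor (G zero zero) * (P₁ * P₂))
    ≈⟨ split-off-zero (G zero zero) ⟩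
      ((if G zero zero then 1# else α zero * Y + β zero) * P₁)
        * ((if G zero zero then α zero * X + β zero else 1#) * P₂)
    ∎
    where
    G′ = delete zero G
    Q = q R x y (α ∘ suc) (β ∘ suc) G′
    P₁ = prodFin R (λ v → if G′ v v then 1# else α (suc v) * Y + β (suc v))
    P₂ = prodFin R (λ v → if G′ v v then α (suc v) * X + β (suc v) else 1#)
    IH : Q ≈ P₁ * P₂
    IH = q-edgeless G′ (α ∘ suc) (β ∘ suc) (λ u v u≢v → edgeless (suc u) (suc v) (u≢v ∘ suc-injective))
    factor : Bool → Carrier
    factor looped = if looped then X else Y
    vertex-factor : ∀ s → monomialOf G (insert zero true s) ≈ factor (G zero zero) * monomialOf G′ s
    vertex-factor s rewrite rank-insert-isolated G zero s (λ u u≢0 → edgeless u zero u≢0)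
                                                         (λ v v≢0 → edgeless zero v (v≢0 ∘ ≡.sym))
      with G zero zero
    ... | true  = monomial-suc-rank (rank G′ s) (card s)
    ... | false = monomial-suc-card {rank G′ s} {card s} (rank≤card G′ s)
    split-off-zero : ∀ looped →
      β zero * (P₁ * P₂) + α zero * (factor looped * (P₁ * P₂))
      ≈ ((if looped then 1# else α zero * Y + β zero) * P₁) * ((if looped then α zero * X + β zero else 1#) * P₂)
    split-off-zero true  = solve 5 (λ a b X p₁ p₂ → b :* (p₁ :* p₂) :+ a :* (X :* (p₁ :* p₂))
                                                 := (con 1 :* p₁) :* ((a :* X :+ b) :* p₂)) refl (α zero) (β zero) X P₁ P₂
    split-off-zero false = solve 5 (λ a b Y p₁ p₂ → b :* (p₁ :* p₂) :+ a :* (Y :* (p₁ :* p₂))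
                                                 := ((a :* Y :+ b) :* p₁) :* (con 1 :* p₂)) refl (α zero) (β zero) Y P₁ P₂

  module _ {n} (G : Graph (suc (suc n))) (α β : Fin (suc (suc n)) → Carrier) (symmetric : SymmetricGraph G)
           {a b : Fin (suc (suc n))} (a≢b : a ≢ b) (Gab : G a b ≡ true) (Gaa : G a a ≡ false) (Gbb : G b b ≡ false)
           where

    private
      H = pivot a b G
      b≢a : b ≢ a
      b≢a b≡a = a≢b (≡.sym b≡a)
      a′ = punchOut b≢a
      b′ = punchOut a≢b
      αᵃ = α ∘ punchIn a
      βᵃ = β ∘ punchIn a
      αᵃᵇ = αᵃ ∘ punchIn b′
      βᵃᵇ = βᵃ ∘ punchIn b′
      A = Σ-weighted αᵃᵇ βᵃᵇ (λ t → monomialOf H (insert a true (insert b′ false t)))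
      C = Σ-weighted αᵃᵇ βᵃᵇ (λ t → monomialOf H (insert a false (insert b′ false t)))

      card-insert₂ : ∀ c d t → card (insert a c (insert b′ d t)) ≡ bit c Data.Nat.+ (bit d Data.Nat.+ card t)
      card-insert₂ c d t = ≡.trans (card-insert a c _) (≡.cong (bit c Data.Nat.+_) (card-insert b′ d t))

      -- Split the subsets through a at b: if b ∉ S pivoting preserves the rank, if b ∈ S it removes a and b
      -- and two units of rank.
      through-a : Σ-weighted αᵃ βᵃ (monomialOf G ∘ insert a true) ≈ β b * A + α b * (X * (X * C))
      through-a =
        begin
          Σ-subsets (suc n) F
        ≈⟨ Σ-split b′ F ⟩
          Σ-subsets n (F ∘ insert b′ false) + Σ-subsets n (F ∘ insert b′ true)
        ≈⟨ +-cong (Σ-factor (β b) (λ t → trans (*-cong (weight-insert b′ false t αᵃ βᵃ) b∉)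
                                               (trans (*-assoc _ _ _) (*-congʳ (reflexive (≡.cong β pab))))))
                  (Σ-factor (α b) (λ t → trans (*-cong (weight-insert b′ true t αᵃ βᵃ) b∈)
                                               (trans (rearrange _ _ _) (*-congʳ (reflexive (≡.cong α pab)))))) ⟩
          β b * A + α b * Σ-subsets n (λ t → X * (X * (weight αᵃᵇ βᵃᵇ t * m₀₀ t)))
        ≈⟨ +-congˡ (*-congˡ (trans (Σ-factor {n} X (λ _ → refl)) (*-congˡ (Σ-factor {n} X (λ _ → refl))))) ⟩
          β b * A + α b * (X * (X * C))
        ∎
        where
        F = λ S → weight αᵃ βᵃ S * monomialOf G (insert a true S)
        m₀₀ = λ t → monomialOf H (insert a false (insert b′ false t))
        pab = punchIn-punchOut a≢b
        rearrange : ∀ c w m → (c * w) * (X * (X * m)) ≈ c * (X * (X * (w * m)))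
        rearrange c w m = solve 4 (λ c w X m → (c :* w) :* (X :* (X :* m)) := c :* (X :* (X :* (w :* m)))) refl c w X m
        b∉ : ∀ {t} → monomialOf G (insert a true (insert b′ false t)) ≈ monomialOf H (insert a true (insert b′ false t))
        b∉ {t} = reflexive (≡.cong (λ r → monomial r (card (insert a true (insert b′ false t))))
                                   (≡.sym (rank-insert-pivot-one G symmetric a≢b Gaa t)))
        b∈ : ∀ {t} → monomialOf G (insert a true (insert b′ true t))
                   ≈ X * (X * monomialOf H (insert a false (insert b′ false t)))
        b∈ {t} = trans (reflexive (≡.cong₂ monomial (rank-insert-pivot-two G symmetric a≢b Gaa t Gbb Gab)
                                                 (≡.trans (card-insert₂ true true t)
                                                          (≡.cong (λ m → suc (suc m)) (≡.sym (card-insert₂ false false t))))))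
                       (trans (monomial-suc-rank (suc r) (suc m)) (*-congˡ (monomial-suc-rank r m)))
          where
          r = rank H (insert a false (insert b′ false t))
          m = card (insert a false (insert b′ false t))

      q-pivot-b : q R x y (α ∘ punchIn b) (β ∘ punchIn b) (delete b H) ≈ β a * C + α a * A
      q-pivot-b =
        trans (q-split a′ (α ∘ punchIn b) (β ∘ punchIn b) (delete b H))
              (+-cong (*-cong (reflexive (≡.cong β pba)) (relabel false))
                      (*-cong (reflexive (≡.cong α pba)) (relabel true)))
        where
        pba = punchIn-punchOut b≢a
        relabel : ∀ c → Σ-weighted (α ∘ punchIn b ∘ punchIn a′) (β ∘ punchIn b ∘ punchIn a′)
                                   (monomialOf (delete b H) ∘ insert a′ c)
                        ≈ Σ-weighted αᵃᵇ βᵃᵇ (λ t → monomialOf H (insert a c (insert b′ false t)))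
        relabel c = Σ-cong (λ t → *-cong
          (prodFin-cong (λ i → reflexive (≡.cong (λ v → if t i then α v else β v)
                                                 (punchIn-punchIn-comm a b a≢b b≢a i))))
          (reflexive (≡.trans (monomialOf-delete H b (insert a′ c t))
                              (monomialOf-cong H (insert-insert-comm a b a≢b b≢a c t)))))

      q-pivot-ab : q R x y αᵃᵇ βᵃᵇ (delete b′ (delete a H)) ≈ C
      q-pivot-ab = trans (q-as-sum αᵃᵇ βᵃᵇ _) (Σ-weighted-cong αᵃᵇ βᵃᵇ (λ t → reflexive
        (≡.trans (monomialOf-delete (delete a H) b′ t) (monomialOf-delete H a (insert b′ false t)))))

    q-pivot : q R x y α β G
      ≈ β a * q R x y αᵃ βᵃ (delete a G)
        + β b * q R x y (α ∘ punchIn b) (β ∘ punchIn b) (delete b H)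
        + (α a * α b * X * X - β a * β b) * q R x y αᵃᵇ βᵃᵇ (delete b′ (delete a H))
    q-pivot =
      begin
        q R x y α β G
      ≈⟨ trans (q-expand a α β G) (+-congˡ (*-congˡ through-a)) ⟩
        β a * Qᵃ + α a * (β b * A + α b * (X * (X * C)))
      ≈⟨ solve 8 (λ βa βb αa αb X Qᵃ A C → βa :* Qᵃ :+ αa :* (βb :* A :+ αb :* (X :* (X :* C)))
                                         := βa :* Qᵃ :+ βb :* αa :* A :+ (αa :* αb :* X :* X) :* C)
                 refl (β a) (β b) (α a) (α b) X Qᵃ A C ⟩
        β a * Qᵃ + β b * α a * A + (α a * α b * X * X) * C
      -- The semiring solver treats D = αa αb X² - βa βb as an atom, via D + βa βb ≈ αa αb X².
      ≈⟨ +-congˡ (*-congʳ (sym (minus-plus (α a * α b * X * X) (β a * β b)))) ⟩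
        β a * Qᵃ + β b * α a * A + ((α a * α b * X * X - β a * β b) + β a * β b) * C
      ≈⟨ solve 7 (λ βa βb αa Qᵃ A D C → βa :* Qᵃ :+ βb :* αa :* A :+ (D :+ βa :* βb) :* C
                                     := βa :* Qᵃ :+ βb :* (βa :* C :+ αa :* A) :+ D :* C)
                 refl (β a) (β b) (α a) Qᵃ A (α a * α b * X * X - β a * β b) C ⟩
        β a * Qᵃ + β b * (β a * C + α a * A) + (α a * α b * X * X - β a * β b) * C
      ≈⟨ sym (+-cong (+-congˡ (*-congˡ q-pivot-b)) (*-congˡ q-pivot-ab)) ⟩
        β a * Qᵃ + β b * q R x y (α ∘ punchIn b) (β ∘ punchIn b) (delete b H)
          + (α a * α b * X * X - β a * β b) * q R x y αᵃᵇ βᵃᵇ (delete b′ (delete a H))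
      ∎
      where
      Qᵃ = q R x y αᵃ βᵃ (delete a G)
      minus-plus : ∀ p r → (p - r) + r ≈ p
      minus-plus p r = trans (+-assoc p (- r) r) (trans (+-congˡ (-‿inverseˡ r)) (+-identityʳ p))

theorem1 : ∀ {c ℓ} (R : CommutativeRing c ℓ) (x y : CommutativeRing.Carrier R) →
    let open CommutativeRing R in
    -- (a)
    (∀ {n} (G : Graph (suc n)) (α β : Fin (suc n) → Carrier) → SymmetricGraph G →
      (a : Fin (suc n)) → G a a ≡ true →
      q R x y α β G
        ≈ β a * q R x y (λ v → α (punchIn a v)) (λ v → β (punchIn a v)) (delete a G)
          + α a * (x - 1#) * q R x y (λ v → α (punchIn a v)) (λ v → β (punchIn a v))
                                     (delete a (localComp a G)))
    ×
    -- (b)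
    (∀ {n} (G : Graph (suc (suc n))) (α β : Fin (suc (suc n)) → Carrier) → SymmetricGraph G →
      (a b : Fin (suc (suc n))) (a≢b : a ≢ b) → G a b ≡ true → G a a ≡ false → G b b ≡ false →
      q R x y α β G
        ≈ β a * q R x y (λ v → α (punchIn a v)) (λ v → β (punchIn a v)) (delete a G)
          + β b * q R x y (λ v → α (punchIn b v)) (λ v → β (punchIn b v))
                          (delete b (pivot a b G))
          + (α a * α b * (x - 1#) * (x - 1#) - β a * β b)
            * q R x y (λ v → α (punchIn a (punchIn (punchOut a≢b) v)))
                      (λ v → β (punchIn a (punchIn (punchOut a≢b) v)))
                      (delete (punchOut a≢b) (delete a (pivot a b G))))
    ×
    -- (c)
    (∀ {n} (G : Graph n) (α β : Fin n → Carrier) → SymmetricGraph G →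
      (∀ u v → u ≢ v → G u v ≡ false) →
      q R x y α β G
        ≈ prodFin R (λ v → if G v v then 1# else α v * (y - 1#) + β v)
          * prodFin R (λ v → if G v v then α v * (x - 1#) + β v else 1#))
theorem1 R x y =
  q-looped ,
  (λ G α β symmetric a b a≢b → q-pivot G α β symmetric a≢b) ,
  (λ G α β _ → q-edgeless G α β)
  where
  open Polynomial R x y
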